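{- For every nonnegative integer $k$, \[ \sum_{C\in\Delta^+_k}\mathrm{wt}_{y,q}(C)\equiv\prod_{i\ge1}(1-q^{2i})(1+yq^{2i-1})(1+y^{ -1}q^{2i-1})\pmod{q^k}. \]
   Context: Partitions are Ferrers diagrams (English convention), $\delta_k=(k,\dots,1)$. $\Delta^+_k$ is the set of pairs $(\lambda,A)$ with $\lambda\subset\delta_{k-1}$ and $A$ a set of arrows, each occupying all cells of a whole row (horizontal arrow) or whole column (vertical arrow) of $\delta_k/\lambda$ (at most one per row/column), such that no outer corner of $\delta_k/\lambda$ (a cell $c\in\delta_k/\lambda$ with $\lambda\cup\{c\}$ a partition) is occupied by two arrows. Arrow length = number of cells occupied, $\|A\|$ = total arrow length. $\mathrm{wt}_{y,q}(\lambda,A)=(-1)^{|A|}q^{2|\lambda|+\|A\|}(-y)^{oh(A)-ov(A)}$, where $oh(A)$ (resp. $ov(A)$) is the number of horizontal (resp. vertical) arrows of odd length. Congruence is as formal power series in $q$ with coefficients Laurent polynomials in $y$. -}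

module Defs where

open import Data.Nat as ℕ using (ℕ; zero; suc; _∸_; _≤ᵇ_; _<ᵇ_; _≡ᵇ_)
open import Data.Integer as ℤ using (ℤ; +_; -[1+_])
open import Data.Bool using (Bool; true; false; _∧_; not; if_then_else_)
open import Data.List using (List; []; _∷_; [_]; map; concatMap; upTo; filterᵇ; foldr; _++_)
open import Data.Bool.ListAction using (and)
open import Data.Nat.ListAction using (sum)
open import Data.Product using (_×_; _,_)
open import Relation.Nullary.Decidable using (⌊_⌋)

-- Finite bivariate polynomials in q (ℕ exponents) and y (ℤ exponents),
-- i.e. polynomials in q with Laurent-polynomial coefficients in y,
-- represented as (unreduced) lists of monomials  c · q^qe · y^ye.

record Term : Set where
  constructor term
  field
    c  : ℤ
    qe : ℕ
    ye : ℤ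
open Term public

Poly : Set
Poly = List Term

one : Poly
one = [ term (+ 1) 0 (+ 0) ]

_⊗_ : Poly → Poly → Poly
p ⊗ r = concatMap (λ a → map (λ b → term (c a ℤ.* c b) (qe a ℕ.+ qe b) (ye a ℤ.+ ye b)) r) p

coeff : ℕ → ℤ → Poly → ℤ
coeff j m = foldr (λ t acc → if (qe t ≡ᵇ j) ∧ ⌊ ye t ℤ.≟ m ⌋ then c t ℤ.+ acc else acc) (+ 0)

-- the factor for i = suc n  (2i = 2n+2, 2i-1 = 2n+1)
factor : ℕ → Poly
factor n =
  (term (+ 1) 0 (+ 0) ∷ term (ℤ.- (+ 1)) (2 ℕ.* n ℕ.+ 2) (+ 0) ∷ []) ⊗
  ((term (+ 1) 0 (+ 0) ∷ term (+ 1) (2 ℕ.* n ℕ.+ 1) (+ 1) ∷ []) ⊗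
   (term (+ 1) 0 (+ 0) ∷ term (+ 1) (2 ℕ.* n ℕ.+ 1) (ℤ.- (+ 1)) ∷ []))

prodUpTo : ℕ → Poly
prodUpTo zero    = one
prodUpTo (suc n) = prodUpTo n ⊗ factor n

-- Every factor with i ≥ j+1 is ≡ 1 mod q^{j+1}, so (by the
-- definition of infinite products of formal power series) this coefficient
-- is the one of the finite product over 1 ≤ i ≤ j+1.
rhsCoeff : ℕ → ℤ → ℤ
rhsCoeff j m = coeff j m (prodUpTo (suc j))

-- Rows and columns are indexed 0-based: r, c ∈ {0,…,k-1}.
-- δ_k has row r of length k - r and column c of length k - c.
-- λ is the list (λ_0,…,λ_{k-1}) of its row lengths (trailing zeros included).
-- λ ⊂ δ_{k-1}  ⇔  λ is a partition with λ_r ≤ k-1-r.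
-- An arrow set A is given by two Boolean lists: rows r carrying a horizontal
-- arrow, columns c carrying a vertical arrow (at most one per row/column).
-- Since λ ⊂ δ_{k-1}, every row/column of δ_k/λ is nonempty.

at : {A : Set} → A → List A → ℕ → A
at d []       _       = d
at d (x ∷ xs) zero    = x
at d (x ∷ xs) (suc n) = at d xs n

bounds : ℕ → List ℕ
bounds zero    = []
bounds (suc n) = n ∷ bounds n

boundedLists : List ℕ → List (List ℕ)
boundedLists []       = [ [] ]
boundedLists (b ∷ bs) = concatMap (λ x → map (x ∷_) (boundedLists bs)) (upTo (suc b))

boolLists : ℕ → List (List Bool)
boolLists zero    = [ [] ]
boolLists (suc n) = concatMap (λ bs → (true ∷ bs) ∷ (false ∷ bs) ∷ []) (boolLists n)

weaklyDecreasing : List ℕ → Bool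
weaklyDecreasing (a ∷ b ∷ rest) = (b ≤ᵇ a) ∧ weaklyDecreasing (b ∷ rest)
weaklyDecreasing _              = true

Config : Set
Config = List ℕ × List Bool × List Bool

candidates : ℕ → List Config
candidates k =
  concatMap (λ lam → concatMap (λ hs → map (λ vs → lam , hs , vs) (boolLists k))
                                (boolLists k))
            (boundedLists (bounds k))

conj : List ℕ → ℕ → ℕ
conj lam c = sum (map (λ x → if c <ᵇ x then 1 else 0) lam)

rowLen : ℕ → List ℕ → ℕ → ℕ
rowLen k lam r = (k ∸ r) ∸ at 0 lam r

colLen : ℕ → List ℕ → ℕ → ℕ
colLen k lam c = (k ∸ c) ∸ conj lam c

-- the outer corner of δ_k/λ in row r exists (it is the cell (r, λ_r)) iff
-- r = 0 or λ_{r-1} > λ_r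
addableRow : List ℕ → ℕ → Bool
addableRow lam zero    = true
addableRow lam (suc r) = at 0 lam (suc r) <ᵇ at 0 lam r

-- no outer corner is occupied by two arrows
cornersOK : ℕ → Config → Bool
cornersOK k (lam , hs , vs) =
  and (map (λ r → not (addableRow lam r ∧ (at false hs r ∧ at false vs (at 0 lam r)))) (upTo k))

inΔ⁺ : ℕ → Config → Bool
inΔ⁺ k C@(lam , hs , vs) = weaklyDecreasing lam ∧ cornersOK k C

Δ⁺ : ℕ → List Config
Δ⁺ k = filterᵇ (inΔ⁺ k) (candidates k)

countWhere : (ℕ → Bool) → ℕ → ℕ
countWhere p k = sum (map (λ i → if p i then 1 else 0) (upTo k))

sumWhere : (ℕ → Bool) → (ℕ → ℕ) → ℕ → ℕ
sumWhere p f k = sum (map (λ i → if p i then f i else 0) (upTo k))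

odd : ℕ → Bool
odd n = not (ℕ._%_ n 2 ≡ᵇ 0)

sgn : ℕ → ℤ
sgn zero          = + 1
sgn (suc zero)    = ℤ.- (+ 1)
sgn (suc (suc n)) = sgn n

-- wt(λ,A) = (-1)^{|A|} q^{2|λ| + ‖A‖} (-y)^{oh(A) - ov(A)}
--   with (-y)^e = (-1)^{|e|} y^e for e ∈ ℤ
wt : ℕ → Config → Term
wt k (lam , hs , vs) =
  term (sgn nA ℤ.* sgn ℤ.∣ e ∣) (2 ℕ.* sum lam ℕ.+ lenA) e
  where
    h : ℕ → Bool
    h r = at false hs r
    v : ℕ → Bool
    v c = at false vs c
    nA   = countWhere h k ℕ.+ countWhere v k
    lenA = sumWhere h (rowLen k lam) k ℕ.+ sumWhere v (colLen k lam) k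
    oh   = countWhere (λ r → h r ∧ odd (rowLen k lam r)) k
    ov   = countWhere (λ c → v c ∧ odd (colLen k lam c)) k
    e    = + oh ℤ.- + ov

lhs : ℕ → Poly
lhs k = map (wt k) (Δ⁺ k)

module Submission where

-- An arrow meeting a nonempty row or column of λ forces
--      q-degree ≥ k, and below q^k no outer corner carries two arrows.  So
--      Σ_{Δ⁺_k} wt ≡ G_k · W_k mod q^k, with G_k = Σ_{λ ⊂ δ_{k-1}} q^{2|λ|} and
--      W_k = Σ_A wt(∅, A) over all arrow sets on the staircase δ_k.
--  (2) Factorisation.  Rows and columns carry arrows independently; a line of
--      length L contributes 1 - q^L (L even) or 1 + y^{±1} q^L (L odd).
--      Computing on δ_{2k}, which agrees with δ_k below q^k, gives
--      W_k ≡ Π_{i≤k} (1-q^{2i})(1+yq^{2i-1})(1+y⁻¹q^{2i-1}) · Π_{i≤k} (1-q^{2i}).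
--  (3) Euler.  Π_{i≤k} (1-q^{2i}) · G_k ≡ 1 mod q^{2k}, by recursion on the
--      largest part of the partitions.
--  (4) Truncation.  The factor for i > j is 1 modulo q^{j+1}, so the product
--      up to k has the same coefficient of q^j as the product up to j+1.

open import Defs
open import Data.Nat using (ℕ; _<_)
open import Data.Integer using (ℤ)
open import Relation.Binary.PropositionalEquality using (_≡_)

open import Data.Nat as ℕ using (zero; suc; _∸_; _≤ᵇ_; _<ᵇ_; _≡ᵇ_; z≤n; s≤s)
open import Data.Integer as ℤ using (+_)
import Data.Nat.Properties as ℕP
import Data.Integer.Properties as ℤP
import Data.Nat.DivMod as ℕD
import Data.List.Properties as LP
open import Data.Integer.Tactic.RingSolver using (solve-∀)
open import Data.Bool using (Bool; true; false; _∧_; not; if_then_else_; T)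
open import Data.Bool.Properties using (∧-zeroʳ)
open import Data.List using (List; []; _∷_; [_]; map; concatMap; upTo; filterᵇ; _++_; applyUpTo)
open import Data.Bool.ListAction using (and)
open import Data.Nat.ListAction using (sum)
open import Data.Product using (_×_; _,_; proj₁; proj₂)
open import Data.Empty using (⊥-elim)
open import Data.Unit using (tt)
open import Relation.Nullary using (¬_; yes; no; Dec)
open import Relation.Nullary.Decidable using (⌊_⌋)
open import Relation.Binary.Definitions using (tri<; tri≈; tri>)
open import Relation.Binary.PropositionalEquality
  using (refl; sym; trans; cong; cong₂; subst; module ≡-Reasoning)
open import Function using (_∘_)
open import Algebra.Bundles using (CommutativeMonoid)
open import Level using (0ℓ)

≡false⇒¬T : ∀ {b} → b ≡ false → ¬ T b
≡false⇒¬T refl ()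

≡true⇒T : ∀ {b} → b ≡ true → T b
≡true⇒T refl = tt

T⇒≡true : ∀ {b} → T b → b ≡ true
T⇒≡true {true} _ = refl

¬T⇒≡false : ∀ {b} → ¬ T b → b ≡ false
¬T⇒≡false {true} n = ⊥-elim (n tt)
¬T⇒≡false {false} n = refl

≤ᵇ-yes : ∀ {m n} → m ℕ.≤ n → (m ≤ᵇ n) ≡ true
≤ᵇ-yes m≤n = T⇒≡true (ℕP.≤⇒≤ᵇ m≤n)

≤ᵇ-no : ∀ {m n} → n < m → (m ≤ᵇ n) ≡ false
≤ᵇ-no {m} {n} n<m = ¬T⇒≡false (λ t → ℕP.<⇒≱ n<m (ℕP.≤ᵇ⇒≤ m n t))

<ᵇ-yes : ∀ {m n} → m < n → (m <ᵇ n) ≡ true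
<ᵇ-yes m<n = T⇒≡true (ℕP.<⇒<ᵇ m<n)

<ᵇ-no : ∀ {m n} → n ℕ.≤ m → (m <ᵇ n) ≡ false
<ᵇ-no {m} {n} n≤m = ¬T⇒≡false (λ t → ℕP.<⇒≱ (ℕP.<ᵇ⇒< m n t) n≤m)

∧-true-l : ∀ {a b} → a ∧ b ≡ true → a ≡ true
∧-true-l {true} e = refl

∧-true-r : ∀ {a b} → a ∧ b ≡ true → b ≡ true
∧-true-r {true} e = e

if-true : ∀ {A : Set} {b} {x y : A} → b ≡ true → (if b then x else y) ≡ x
if-true refl = refl

if-zero : ∀ b {x} → x ≡ + 0 → (if b then x else + 0) ≡ + 0
if-zero true e = e
if-zero false e = refl

∑ : {A : Set} → List A → (A → ℤ) → ℤ
∑ [] f = + 0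
∑ (x ∷ xs) f = f x ℤ.+ ∑ xs f

∑-++ : {A : Set} (xs ys : List A) (f : A → ℤ) → ∑ (xs ++ ys) f ≡ ∑ xs f ℤ.+ ∑ ys f
∑-++ [] ys f = sym (ℤP.+-identityˡ _)
∑-++ (x ∷ xs) ys f = trans (cong (ℤ._+_ (f x)) (∑-++ xs ys f)) (sym (ℤP.+-assoc (f x) _ _))

∑-map : {A B : Set} (g : A → B) (xs : List A) (f : B → ℤ) → ∑ (map g xs) f ≡ ∑ xs (f ∘ g)
∑-map g [] f = refl
∑-map g (x ∷ xs) f = cong (ℤ._+_ (f (g x))) (∑-map g xs f)

∑-concatMap : {A B : Set} (g : A → List B) (xs : List A) (f : B → ℤ) →
  ∑ (concatMap g xs) f ≡ ∑ xs (λ x → ∑ (g x) f)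
∑-concatMap g [] f = refl
∑-concatMap g (x ∷ xs) f = trans (∑-++ (g x) _ f) (cong (ℤ._+_ (∑ (g x) f)) (∑-concatMap g xs f))

∑-cong : {A : Set} (xs : List A) {f g : A → ℤ} → (∀ x → f x ≡ g x) → ∑ xs f ≡ ∑ xs g
∑-cong [] e = refl
∑-cong (x ∷ xs) e = cong₂ ℤ._+_ (e x) (∑-cong xs e)

∑-+ : {A : Set} (xs : List A) (f g : A → ℤ) → ∑ xs (λ x → f x ℤ.+ g x) ≡ ∑ xs f ℤ.+ ∑ xs g
∑-+ [] f g = refl
∑-+ (x ∷ xs) f g = trans (cong (ℤ._+_ (f x ℤ.+ g x)) (∑-+ xs f g)) (interchange (f x) (g x) (∑ xs f) (∑ xs g))
  where
  interchange : ∀ a b c d → a ℤ.+ b ℤ.+ (c ℤ.+ d) ≡ a ℤ.+ c ℤ.+ (b ℤ.+ d)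
  interchange = solve-∀

∑-0 : {A : Set} (xs : List A) → ∑ xs (λ _ → + 0) ≡ + 0
∑-0 [] = refl
∑-0 (x ∷ xs) = trans (ℤP.+-identityˡ _) (∑-0 xs)

∑-*ˡ : {A : Set} (xs : List A) (z : ℤ) (f : A → ℤ) → ∑ xs (λ x → z ℤ.* f x) ≡ z ℤ.* ∑ xs f
∑-*ˡ [] z f = sym (ℤP.*-zeroʳ z)
∑-*ˡ (x ∷ xs) z f = trans (cong (ℤ._+_ (z ℤ.* f x)) (∑-*ˡ xs z f)) (sym (ℤP.*-distribˡ-+ z (f x) _))

∑-neg : {A : Set} (xs : List A) (f : A → ℤ) → ∑ xs (λ x → ℤ.- f x) ≡ ℤ.- ∑ xs f
∑-neg [] f = refl
∑-neg (x ∷ xs) f = trans (cong (ℤ._+_ (ℤ.- f x)) (∑-neg xs f)) (sym (ℤP.neg-distrib-+ (f x) _))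

∑-swap : {A B : Set} (xs : List A) (ys : List B) (F : A → B → ℤ) →
  ∑ xs (λ x → ∑ ys (F x)) ≡ ∑ ys (λ y → ∑ xs (λ x → F x y))
∑-swap [] ys F = sym (∑-0 ys)
∑-swap (x ∷ xs) ys F = trans (cong (ℤ._+_ (∑ ys (F x))) (∑-swap xs ys F)) (sym (∑-+ ys (F x) _))

∑-filter : {A : Set} (P : A → Bool) (xs : List A) (f : A → ℤ) →
  ∑ (filterᵇ P xs) f ≡ ∑ xs (λ x → if P x then f x else + 0)
∑-filter P [] f = refl
∑-filter P (x ∷ xs) f with P x
... | true = cong (ℤ._+_ (f x)) (∑-filter P xs f)
... | false = trans (∑-filter P xs f) (sym (ℤP.+-identityˡ _))

∑-if : {A : Set} (b : Bool) (z : ℤ) (f : A → ℤ) (xs : List A) →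
  ∑ xs (λ x → if b then z ℤ.* f x else + 0) ≡ (if b then z ℤ.* ∑ xs f else + 0)
∑-if true z f xs = ∑-*ˡ xs z f
∑-if false z f xs = ∑-0 xs

∑-upTo-suc : ∀ N (f : ℕ → ℤ) → ∑ (upTo (suc N)) f ≡ ∑ (upTo N) f ℤ.+ f N
∑-upTo-suc N f = begin
  ∑ (upTo (suc N)) f            ≡⟨ cong (λ l → ∑ l f) (sym (LP.upTo-∷ʳ N)) ⟩
  ∑ (upTo N ++ [ N ]) f         ≡⟨ ∑-++ (upTo N) [ N ] f ⟩
  ∑ (upTo N) f ℤ.+ (f N ℤ.+ + 0) ≡⟨ cong (ℤ._+_ (∑ (upTo N) f)) (ℤP.+-identityʳ (f N)) ⟩
  ∑ (upTo N) f ℤ.+ f N          ∎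
  where open ≡-Reasoning

contrib : ℕ → ℤ → Term → ℤ
contrib j m t = if (qe t ≡ᵇ j) ∧ ⌊ ye t ℤ.≟ m ⌋ then c t else + 0

⟦_⟧ : Poly → ℕ → ℤ → ℤ
⟦ p ⟧ j m = ∑ p (contrib j m)

coeff≡⟦⟧ : ∀ j m p → coeff j m p ≡ ⟦ p ⟧ j m
coeff≡⟦⟧ j m [] = refl
coeff≡⟦⟧ j m (t ∷ p) with (qe t ≡ᵇ j) ∧ ⌊ ye t ℤ.≟ m ⌋
... | true = cong (ℤ._+_ (c t)) (coeff≡⟦⟧ j m p)
... | false = trans (coeff≡⟦⟧ j m p) (sym (ℤP.+-identityˡ _))

contrib-hit : ∀ {j m} t → qe t ≡ j → ye t ≡ m → contrib j m t ≡ c t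
contrib-hit {j} {m} t p q with qe t ≡ᵇ j in e | ye t ℤ.≟ m
... | true  | yes _ = refl
... | true  | no ¬q = ⊥-elim (¬q q)
... | false | _ = ⊥-elim (≡false⇒¬T e (ℕP.≡⇒≡ᵇ _ _ p))

contrib-missq : ∀ {j m} t → ¬ (qe t ≡ j) → contrib j m t ≡ + 0
contrib-missq {j} {m} t ¬p with qe t ≡ᵇ j in e
... | true = ⊥-elim (¬p (ℕP.≡ᵇ⇒≡ _ _ (≡true⇒T e)))
... | false = refl

contrib-missy : ∀ {j m} t → ¬ (ye t ≡ m) → contrib j m t ≡ + 0
contrib-missy {j} {m} t ¬q with qe t ≡ᵇ j | ye t ℤ.≟ m
... | true  | yes q = ⊥-elim (¬q q)
... | true  | no _ = refl
... | false | _ = refl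

contrib-high : ∀ {j k} m t → j < k → k ℕ.≤ qe t → contrib j m t ≡ + 0
contrib-high m t j<k k≤t = contrib-missq t (λ e → ℕP.<⇒≱ j<k (subst (_ ℕ.≤_) e k≤t))

contrib-cong : ∀ j m {t u} → c t ≡ c u → qe t ≡ qe u → ye t ≡ ye u → contrib j m t ≡ contrib j m u
contrib-cong j m {term _ _ _} {term _ _ _} refl refl refl = refl

mulTerm : Term → Term → Term
mulTerm a b = term (c a ℤ.* c b) (qe a ℕ.+ qe b) (ye a ℤ.+ ye b)

mulTerm-comm : ∀ a b → mulTerm a b ≡ mulTerm b a
mulTerm-comm a b = cong₂ (λ x (yz : ℕ × ℤ) → term x (proj₁ yz) (proj₂ yz))
  (ℤP.*-comm (c a) (c b)) (cong₂ _,_ (ℕP.+-comm (qe a) (qe b)) (ℤP.+-comm (ye a) (ye b)))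

mulTerm-assoc : ∀ a b d → mulTerm (mulTerm a b) d ≡ mulTerm a (mulTerm b d)
mulTerm-assoc a b d = cong₂ (λ x (yz : ℕ × ℤ) → term x (proj₁ yz) (proj₂ yz))
  (ℤP.*-assoc (c a) (c b) (c d))
  (cong₂ _,_ (ℕP.+-assoc (qe a) (qe b) (qe d)) (ℤP.+-assoc (ye a) (ye b) (ye d)))

∑-⊗ : ∀ p r (F : Term → ℤ) → ∑ (p ⊗ r) F ≡ ∑ p (λ a → ∑ r (λ b → F (mulTerm a b)))
∑-⊗ p r F = trans (∑-concatMap (λ a → map (mulTerm a) r) p F) (∑-cong p (λ a → ∑-map (mulTerm a) r F))

contrib-mulTerm : ∀ j m a b → contrib j m (mulTerm a b) ≡
   (if qe a ≤ᵇ j then c a ℤ.* contrib (j ∸ qe a) (m ℤ.- ye a) b else + 0)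
contrib-mulTerm j m a b with qe a ≤ᵇ j in e
... | false = contrib-missq (mulTerm a b)
      (λ p → ≡false⇒¬T e (ℕP.≤⇒≤ᵇ (subst (qe a ℕ.≤_) p (ℕP.m≤m+n (qe a) (qe b)))))
... | true = shifted (qe b ℕ.≟ j ∸ qe a) (ye b ℤ.≟ m ℤ.- ye a)
  where
  a≤j : qe a ℕ.≤ j
  a≤j = ℕP.≤ᵇ⇒≤ _ _ (≡true⇒T e)
  zero-right : ∀ {x} → x ≡ + 0 → + 0 ≡ c a ℤ.* x
  zero-right refl = sym (ℤP.*-zeroʳ (c a))
  shifted : Dec (qe b ≡ j ∸ qe a) → Dec (ye b ≡ m ℤ.- ye a) →
            contrib j m (mulTerm a b) ≡ c a ℤ.* contrib (j ∸ qe a) (m ℤ.- ye a) b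
  shifted (yes p) (yes q) = trans
    (contrib-hit (mulTerm a b) (trans (cong (qe a ℕ.+_) p) (ℕP.m+[n∸m]≡n a≤j))
      (trans (cong (ℤ._+_ (ye a)) q) (add-sub-cancel (ye a) m)))
    (cong (ℤ._*_ (c a)) (sym (contrib-hit b p q)))
    where
    add-sub-cancel : ∀ s n → s ℤ.+ (n ℤ.- s) ≡ n
    add-sub-cancel = solve-∀
  shifted (no ¬p) _ = trans
    (contrib-missq (mulTerm a b) (λ e → ¬p (trans (sym (ℕP.m+n∸m≡n (qe a) (qe b))) (cong (_∸ qe a) e))))
    (zero-right (contrib-missq b ¬p))
  shifted (yes p) (no ¬q) = trans
    (contrib-missy (mulTerm a b) (λ e → ¬q (trans (sym (cancel (ye a) (ye b))) (cong (ℤ._- ye a) e))))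
    (zero-right (contrib-missy b ¬q))
    where
    cancel : ∀ s t → s ℤ.+ t ℤ.- s ≡ t
    cancel = solve-∀

⟦⊗⟧ : ∀ p r j m → ⟦ p ⊗ r ⟧ j m ≡
  ∑ p (λ a → if qe a ≤ᵇ j then c a ℤ.* ⟦ r ⟧ (j ∸ qe a) (m ℤ.- ye a) else + 0)
⟦⊗⟧ p r j m = trans (∑-⊗ p r (contrib j m)) (∑-cong p (λ a →
  trans (∑-cong r (contrib-mulTerm j m a)) (∑-if (qe a ≤ᵇ j) (c a) (contrib (j ∸ qe a) (m ℤ.- ye a)) r)))

⟦++⟧ : ∀ p r j m → ⟦ p ++ r ⟧ j m ≡ ⟦ p ⟧ j m ℤ.+ ⟦ r ⟧ j m
⟦++⟧ p r j m = ∑-++ p r (contrib j m)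

neg : Poly → Poly
neg = map (λ t → term (ℤ.- c t) (qe t) (ye t))

⟦neg⟧ : ∀ p j m → ⟦ neg p ⟧ j m ≡ ℤ.- ⟦ p ⟧ j m
⟦neg⟧ p j m = trans (∑-map _ p (contrib j m)) (trans (∑-cong p (λ t → neg-if _ (c t))) (∑-neg p (contrib j m)))
  where
  neg-if : ∀ (b : Bool) (z : ℤ) → (if b then ℤ.- z else + 0) ≡ ℤ.- (if b then z else + 0)
  neg-if true z = refl
  neg-if false z = refl

infix 4 _≈_ _≈[_]_

record _≈_ (p r : Poly) : Set where
  constructor ≈-intro
  field same : ∀ j m → ⟦ p ⟧ j m ≡ ⟦ r ⟧ j m
open _≈_ public

record _≈[_]_ (p : Poly) (k : ℕ) (r : Poly) : Set where
  constructor ≈k-intro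
  field sameBelow : ∀ j m → j < k → ⟦ p ⟧ j m ≡ ⟦ r ⟧ j m
open _≈[_]_ public

≈-refl : ∀ {p} → p ≈ p
≈-refl = ≈-intro λ j m → refl

≈-sym : ∀ {p r} → p ≈ r → r ≈ p
≈-sym e = ≈-intro λ j m → sym (same e j m)

≈-trans : ∀ {p r s} → p ≈ r → r ≈ s → p ≈ s
≈-trans e f = ≈-intro λ j m → trans (same e j m) (same f j m)

≈-reflexive : ∀ {p r} → p ≡ r → p ≈ r
≈-reflexive refl = ≈-refl

≈k-refl : ∀ {p k} → p ≈[ k ] p
≈k-refl = ≈k-intro λ j m _ → refl

≈k-sym : ∀ {p r k} → p ≈[ k ] r → r ≈[ k ] p
≈k-sym e = ≈k-intro λ j m l → sym (sameBelow e j m l)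

≈k-trans : ∀ {p r s k} → p ≈[ k ] r → r ≈[ k ] s → p ≈[ k ] s
≈k-trans e f = ≈k-intro λ j m l → trans (sameBelow e j m l) (sameBelow f j m l)

≈⇒≈k : ∀ {p r k} → p ≈ r → p ≈[ k ] r
≈⇒≈k e = ≈k-intro λ j m _ → same e j m

≈k-mono : ∀ {p r k k'} → k' ℕ.≤ k → p ≈[ k ] r → p ≈[ k' ] r
≈k-mono le e = ≈k-intro λ j m l → sameBelow e j m (ℕP.<-≤-trans l le)

≈k⇒≈ : ∀ {p r} → (∀ k → p ≈[ k ] r) → p ≈ r
≈k⇒≈ e = ≈-intro λ j m → sameBelow (e (suc j)) j m (ℕP.n<1+n j)

infixr 2 _≈k⟨_⟩_ _≈⟨_⟩_
infix 3 _∎k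
_≈k⟨_⟩_ : ∀ p {r s k} → p ≈[ k ] r → r ≈[ k ] s → p ≈[ k ] s
p ≈k⟨ e ⟩ f = ≈k-trans e f
_≈⟨_⟩_ : ∀ p {r s k} → p ≈ r → r ≈[ k ] s → p ≈[ k ] s
p ≈⟨ e ⟩ f = ≈k-trans (≈⇒≈k e) f
_∎k : ∀ p {k} → p ≈[ k ] p
p ∎k = ≈k-refl

⊗-comm : ∀ p r → p ⊗ r ≈ r ⊗ p
⊗-comm p r = ≈-intro λ j m → begin
  ∑ (p ⊗ r) (contrib j m)                                   ≡⟨ ∑-⊗ p r (contrib j m) ⟩
  ∑ p (λ a → ∑ r (λ b → contrib j m (mulTerm a b)))         ≡⟨ ∑-swap p r _ ⟩
  ∑ r (λ b → ∑ p (λ a → contrib j m (mulTerm a b)))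
    ≡⟨ ∑-cong r (λ b → ∑-cong p (λ a → cong (contrib j m) (mulTerm-comm a b))) ⟩
  ∑ r (λ b → ∑ p (λ a → contrib j m (mulTerm b a)))         ≡⟨ sym (∑-⊗ r p (contrib j m)) ⟩
  ∑ (r ⊗ p) (contrib j m)                                   ∎
  where open ≡-Reasoning

⊗-assoc : ∀ p r s → (p ⊗ r) ⊗ s ≈ p ⊗ (r ⊗ s)
⊗-assoc p r s = ≈-intro λ j m → begin
  ∑ ((p ⊗ r) ⊗ s) (contrib j m)
    ≡⟨ trans (∑-⊗ (p ⊗ r) s _) (∑-⊗ p r _) ⟩
  ∑ p (λ a → ∑ r (λ b → ∑ s (λ d → contrib j m (mulTerm (mulTerm a b) d))))
    ≡⟨ ∑-cong p (λ a → ∑-cong r (λ b → ∑-cong s (λ d → cong (contrib j m) (mulTerm-assoc a b d)))) ⟩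
  ∑ p (λ a → ∑ r (λ b → ∑ s (λ d → contrib j m (mulTerm a (mulTerm b d)))))
    ≡⟨ sym (trans (∑-⊗ p (r ⊗ s) _) (∑-cong p (λ a → ∑-⊗ r s _))) ⟩
  ∑ (p ⊗ (r ⊗ s)) (contrib j m) ∎
  where open ≡-Reasoning

⊗-distribˡ : ∀ p r s → p ⊗ (r ++ s) ≈ (p ⊗ r) ++ (p ⊗ s)
⊗-distribˡ p r s = ≈-intro λ j m → begin
  ∑ (p ⊗ (r ++ s)) (contrib j m)
    ≡⟨ trans (∑-⊗ p (r ++ s) _) (∑-cong p (λ a → ∑-++ r s _)) ⟩
  ∑ p (λ a → ∑ r (λ b → contrib j m (mulTerm a b)) ℤ.+ ∑ s (λ b → contrib j m (mulTerm a b)))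
    ≡⟨ ∑-+ p _ _ ⟩
  ∑ p (λ a → ∑ r (λ b → contrib j m (mulTerm a b))) ℤ.+ ∑ p (λ a → ∑ s (λ b → contrib j m (mulTerm a b)))
    ≡⟨ sym (trans (⟦++⟧ (p ⊗ r) (p ⊗ s) j m) (cong₂ ℤ._+_ (∑-⊗ p r _) (∑-⊗ p s _))) ⟩
  ∑ ((p ⊗ r) ++ (p ⊗ s)) (contrib j m) ∎
  where open ≡-Reasoning

⊗-identityˡ : ∀ p → one ⊗ p ≈ p
⊗-identityˡ p = ≈-intro λ j m → trans (∑-⊗ one p (contrib j m)) (trans (ℤP.+-identityʳ _)
  (∑-cong p (λ b → contrib-cong j m {u = b} (ℤP.*-identityˡ (c b)) refl (ℤP.+-identityˡ (ye b)))))

⊗-identityʳ : ∀ p → p ⊗ one ≈ p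
⊗-identityʳ p = ≈-trans (⊗-comm p one) (⊗-identityˡ p)

scaled-if-cong : ∀ b z {x y} → (b ≡ true → x ≡ y) → (if b then z ℤ.* x else + 0) ≡ (if b then z ℤ.* y else + 0)
scaled-if-cong true z e = cong (ℤ._*_ z) (e refl)
scaled-if-cong false z e = refl

-- Multiplication respects congruence mod q^k: coefficients of q^j in p ⊗ r
-- only involve coefficients of r of degree ≤ j.
⊗-congʳk : ∀ p {r r' k} → r ≈[ k ] r' → p ⊗ r ≈[ k ] p ⊗ r'
⊗-congʳk p {r} {r'} e = ≈k-intro λ j m j<k →
  trans (⟦⊗⟧ p r j m) (trans (∑-cong p (λ a → scaled-if-cong (qe a ≤ᵇ j) (c a) λ _ →
    sameBelow e _ _ (ℕP.≤-<-trans (ℕP.m∸n≤m j (qe a)) j<k))) (sym (⟦⊗⟧ p r' j m)))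

⊗-congˡk : ∀ {p p'} r {k} → p ≈[ k ] p' → p ⊗ r ≈[ k ] p' ⊗ r
⊗-congˡk {p} {p'} r e =
  p ⊗ r ≈⟨ ⊗-comm p r ⟩ r ⊗ p ≈k⟨ ⊗-congʳk r e ⟩ r ⊗ p' ≈⟨ ⊗-comm r p' ⟩ p' ⊗ r ∎k

⊗-congk : ∀ {p p' r r' k} → p ≈[ k ] p' → r ≈[ k ] r' → p ⊗ r ≈[ k ] p' ⊗ r'
⊗-congk {p} {p'} {r} {r'} e f = ≈k-trans (⊗-congˡk r e) (⊗-congʳk p' f)

++-congk : ∀ {p p' r r' k} → p ≈[ k ] p' → r ≈[ k ] r' → (p ++ r) ≈[ k ] (p' ++ r')
++-congk {p} {p'} {r} {r'} e f = ≈k-intro λ j m l →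
  trans (⟦++⟧ p r j m) (trans (cong₂ ℤ._+_ (sameBelow e j m l) (sameBelow f j m l)) (sym (⟦++⟧ p' r' j m)))

⊗-cong : ∀ {p p' r r'} → p ≈ p' → r ≈ r' → p ⊗ r ≈ p' ⊗ r'
⊗-cong e f = ≈k⇒≈ λ k → ⊗-congk (≈⇒≈k e) (≈⇒≈k f)

⊗-congʳ : ∀ p {r r'} → r ≈ r' → p ⊗ r ≈ p ⊗ r'
⊗-congʳ p = ⊗-cong (≈-refl {p})

⊗-congˡ : ∀ {p p'} r → p ≈ p' → p ⊗ r ≈ p' ⊗ r
⊗-congˡ r e = ⊗-cong e (≈-refl {r})

++-cong : ∀ {p p' r r'} → p ≈ p' → r ≈ r' → (p ++ r) ≈ (p' ++ r')
++-cong e f = ≈k⇒≈ λ k → ++-congk (≈⇒≈k e) (≈⇒≈k f)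

monomial-shift : ∀ t {r r' k k'} → k ℕ.≤ qe t ℕ.+ k' → r ≈[ k' ] r' → [ t ] ⊗ r ≈[ k ] [ t ] ⊗ r'
monomial-shift t {r} {r'} {k} {k'} le e = ≈k-intro λ j m j<k →
  trans (⟦⊗⟧ [ t ] r j m) (trans (cong (ℤ._+ + 0) (scaled-if-cong (qe t ≤ᵇ j) (c t) λ t≤j →
    sameBelow e _ _ (lowered j j<k (ℕP.≤ᵇ⇒≤ (qe t) j (≡true⇒T t≤j))))) (sym (⟦⊗⟧ [ t ] r' j m)))
  where
  lowered : ∀ j → j < k → qe t ℕ.≤ j → j ∸ qe t < k'
  lowered j j<k t≤j = ℕP.+-cancelˡ-< (qe t) _ _
    (subst (_< qe t ℕ.+ k') (sym (ℕP.m+[n∸m]≡n t≤j)) (ℕP.<-≤-trans j<k le))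

drop-high : ∀ t u {k} → k ℕ.≤ qe u → (t ∷ u ∷ []) ≈[ k ] [ t ]
drop-high t u le = ≈k-intro λ j m l → cong (ℤ._+_ (contrib j m t)) (cong (ℤ._+ + 0) (contrib-high m u l le))

cancel-neg : ∀ t → ((one ++ neg [ t ]) ++ [ t ]) ≈ one
cancel-neg t = ≈-intro λ j m → begin
  ⟦ (one ++ neg [ t ]) ++ [ t ] ⟧ j m
    ≡⟨ trans (⟦++⟧ (one ++ neg [ t ]) [ t ] j m) (cong (ℤ._+ ⟦ [ t ] ⟧ j m) (⟦++⟧ one (neg [ t ]) j m)) ⟩
  ⟦ one ⟧ j m ℤ.+ ⟦ neg [ t ] ⟧ j m ℤ.+ ⟦ [ t ] ⟧ j m
    ≡⟨ cong (λ x → ⟦ one ⟧ j m ℤ.+ x ℤ.+ ⟦ [ t ] ⟧ j m) (⟦neg⟧ [ t ] j m) ⟩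
  ⟦ one ⟧ j m ℤ.+ ℤ.- ⟦ [ t ] ⟧ j m ℤ.+ ⟦ [ t ] ⟧ j m
    ≡⟨ minus-plus (⟦ one ⟧ j m) (⟦ [ t ] ⟧ j m) ⟩
  ⟦ one ⟧ j m ∎
  where
  open ≡-Reasoning
  minus-plus : ∀ a b → a ℤ.+ ℤ.- b ℤ.+ b ≡ a
  minus-plus = solve-∀

PolyMonoid : CommutativeMonoid 0ℓ 0ℓ
PolyMonoid = record
  { Carrier = Poly ; _≈_ = _≈_ ; _∙_ = _⊗_ ; ε = one
  ; isCommutativeMonoid = record
    { isMonoid = record
      { isSemigroup = record
        { isMagma = record
          { isEquivalence = record { refl = ≈-refl ; sym = ≈-sym ; trans = ≈-trans }
          ; ∙-cong = ⊗-cong }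
        ; assoc = ⊗-assoc }
      ; identity = ⊗-identityˡ , ⊗-identityʳ }
    ; comm = ⊗-comm } }

import Algebra.Solver.CommutativeMonoid PolyMonoid as ⊗-Solver
open ⊗-Solver using (_⊕_; _⊜_)

sum-applyUpTo-cong : ∀ (h : ℕ → ℕ) N (F G : ℕ → ℕ) → (∀ i → i < N → F (h i) ≡ G (h i)) →
  sum (map F (applyUpTo h N)) ≡ sum (map G (applyUpTo h N))
sum-applyUpTo-cong h zero F G e = refl
sum-applyUpTo-cong h (suc N) F G e =
  cong₂ ℕ._+_ (e 0 (s≤s z≤n)) (sum-applyUpTo-cong (h ∘ suc) N F G (λ i l → e (suc i) (s≤s l)))

∑-applyUpTo-cong : ∀ (h : ℕ → ℕ) N {f g : ℕ → ℤ} → (∀ i → i < N → f (h i) ≡ g (h i)) →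
  ∑ (applyUpTo h N) f ≡ ∑ (applyUpTo h N) g
∑-applyUpTo-cong h zero e = refl
∑-applyUpTo-cong h (suc N) e =
  cong₂ ℤ._+_ (e 0 (s≤s z≤n)) (∑-applyUpTo-cong (h ∘ suc) N (λ i l → e (suc i) (s≤s l)))

sum-applyUpTo-≥ : ∀ (h : ℕ → ℕ) N (F : ℕ → ℕ) i → i < N → F (h i) ℕ.≤ sum (map F (applyUpTo h N))
sum-applyUpTo-≥ h (suc N) F zero l = ℕP.m≤m+n _ _
sum-applyUpTo-≥ h (suc N) F (suc i) (s≤s l) =
  ℕP.≤-trans (sum-applyUpTo-≥ (h ∘ suc) N F i l) (ℕP.m≤n+m _ (F (h 0)))

and-applyUpTo : ∀ (h : ℕ → ℕ) N (F : ℕ → Bool) → (∀ i → i < N → F (h i) ≡ true) →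
  and (map F (applyUpTo h N)) ≡ true
and-applyUpTo h zero F e = refl
and-applyUpTo h (suc N) F e rewrite e 0 (s≤s z≤n) = and-applyUpTo (h ∘ suc) N F (λ i l → e (suc i) (s≤s l))

sumWhere-cong : ∀ (p : ℕ → Bool) (f g : ℕ → ℕ) k → (∀ i → i < k → p i ≡ true → f i ≡ g i) →
  sumWhere p f k ≡ sumWhere p g k
sumWhere-cong p f g k e = sum-applyUpTo-cong (λ x → x) k _ _ pointwise
  where
  pointwise : ∀ i → i < k → (if p i then f i else 0) ≡ (if p i then g i else 0)
  pointwise i l with p i in pi
  ... | true = e i l pi
  ... | false = refl

countOdd-cong : ∀ (p : ℕ → Bool) (f g : ℕ → ℕ) k → (∀ i → i < k → p i ≡ true → f i ≡ g i) →
  countWhere (λ i → p i ∧ odd (f i)) k ≡ countWhere (λ i → p i ∧ odd (g i)) k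
countOdd-cong p f g k e = sum-applyUpTo-cong (λ x → x) k _ _ pointwise
  where
  pointwise : ∀ i → i < k → (if p i ∧ odd (f i) then 1 else 0) ≡ (if p i ∧ odd (g i) then 1 else 0)
  pointwise i l with p i in pi
  ... | true rewrite e i l pi = refl
  ... | false = refl

sumWhere-≥ : ∀ (p : ℕ → Bool) f k i → i < k → p i ≡ true → f i ℕ.≤ sumWhere p f k
sumWhere-≥ p f k i l pi = subst (ℕ._≤ sumWhere p f k) (selected (p i) pi)
  (sum-applyUpTo-≥ (λ x → x) k (λ i → if p i then f i else 0) i l)
  where
  selected : ∀ b → b ≡ true → (if b then f i else 0) ≡ f i
  selected true _ = refl

decreasing-tail : ∀ a rest → weaklyDecreasing (a ∷ rest) ≡ true → weaklyDecreasing rest ≡ true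
decreasing-tail a [] w = refl
decreasing-tail a (b ∷ rest) w = ∧-true-r {b ≤ᵇ a} w

decreasing-head : ∀ a rest r → weaklyDecreasing (a ∷ rest) ≡ true → at 0 rest r ℕ.≤ a
decreasing-head a [] r w = z≤n
decreasing-head a (b ∷ rest) zero w = ℕP.≤ᵇ⇒≤ b a (≡true⇒T (∧-true-l w))
decreasing-head a (b ∷ rest) (suc r) w =
  ℕP.≤-trans (decreasing-head b rest r (∧-true-r w)) (ℕP.≤ᵇ⇒≤ b a (≡true⇒T (∧-true-l {b ≤ᵇ a} w)))

part≤size : ∀ lam r → at 0 lam r ℕ.≤ sum lam
part≤size [] r = z≤n
part≤size (a ∷ lam) zero = ℕP.m≤m+n a _
part≤size (a ∷ lam) (suc r) = ℕP.≤-trans (part≤size lam r) (ℕP.m≤n+m _ a)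

-- If row r of λ is nonempty then rows 0..r are, so r < |λ|.
nonemptyRow<size : ∀ lam r → weaklyDecreasing lam ≡ true → 0 < at 0 lam r → r < sum lam
nonemptyRow<size [] r w ()
nonemptyRow<size (a ∷ lam) zero w p = ℕP.<-≤-trans p (ℕP.m≤m+n a _)
nonemptyRow<size (a ∷ lam) (suc r) w p =
  ℕP.+-mono-≤ (ℕP.<-≤-trans p (decreasing-head a lam r w)) (nonemptyRow<size lam r (decreasing-tail a lam w) p)

conj≤size : ∀ lam c → conj lam c ℕ.≤ sum lam
conj≤size [] c = z≤n
conj≤size (x ∷ lam) c = ℕP.+-mono-≤ (indicator≤ (c <ᵇ x) refl) (conj≤size lam c)
  where
  indicator≤ : ∀ b → (c <ᵇ x) ≡ b → (if b then 1 else 0) ℕ.≤ x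
  indicator≤ true e = ℕP.≤-trans (s≤s z≤n) (ℕP.<ᵇ⇒< c x (≡true⇒T e))
  indicator≤ false e = z≤n

nonemptyCol<size : ∀ lam c → 0 < conj lam c → c < sum lam
nonemptyCol<size [] c ()
nonemptyCol<size (x ∷ lam) c p = split (c <ᵇ x) refl p
  where
  split : ∀ b → (c <ᵇ x) ≡ b → 0 < (if b then 1 else 0) ℕ.+ conj lam c → c < x ℕ.+ sum lam
  split true e _ = ℕP.<-≤-trans (ℕP.<ᵇ⇒< c x (≡true⇒T e)) (ℕP.m≤m+n x _)
  split false e q = ℕP.<-≤-trans (nonemptyCol<size lam c q) (ℕP.m≤n+m _ x)

-- Step (1): reduction to the empty partition.

-- Weight of an arrow set when row r has length rl r and column c length cl c.
-- Thus wt k (λ , A) is q^{2|λ|} times the weight for the lengths of δ_k/λ,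
-- and wt k ([] , A) is the weight for the lengths of δ_k.
arrowWeight : ℕ → (ℕ → ℕ) → (ℕ → ℕ) → List Bool → List Bool → Term
arrowWeight k rl cl hs vs = term (sgn nA ℤ.* sgn ℤ.∣ e ∣) lenA e
  where
    h : ℕ → Bool
    h r = at false hs r
    v : ℕ → Bool
    v c = at false vs c
    nA   = countWhere h k ℕ.+ countWhere v k
    lenA = sumWhere h rl k ℕ.+ sumWhere v cl k
    oh   = countWhere (λ r → h r ∧ odd (rl r)) k
    ov   = countWhere (λ c → v c ∧ odd (cl c)) k
    e    = + oh ℤ.- + ov

arrowWeight-cong : ∀ k rl rl' cl cl' hs vs →
  (∀ r → r < k → at false hs r ≡ true → rl r ≡ rl' r) →
  (∀ c → c < k → at false vs c ≡ true → cl c ≡ cl' c) →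
  arrowWeight k rl cl hs vs ≡ arrowWeight k rl' cl' hs vs
arrowWeight-cong k rl rl' cl cl' hs vs er ec
  rewrite sumWhere-cong (at false hs) rl rl' k er | sumWhere-cong (at false vs) cl cl' k ec
        | countOdd-cong (at false hs) rl rl' k er | countOdd-cong (at false vs) cl cl' k ec = refl

-- λ ⊂ δ_{k-1}, i.e. λ_r ≤ k-1-r for every row r < k.
InsideStaircase : ℕ → List ℕ → Set
InsideStaircase n lam = ∀ r → r < n → at 0 lam r ℕ.+ r < n

-- k ≤ 2L + (k - a) as soon as a ≤ 2L (the cells before an arrow number ≤ 2|λ|).
reach : ∀ a L k → a ℕ.≤ 2 ℕ.* L → k ℕ.≤ 2 ℕ.* L ℕ.+ (k ∸ a)
reach a L k le = ℕP.≤-trans (ℕP.m≤n+m∸n k a) (ℕP.+-monoˡ-≤ (k ∸ a) le)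

double : ∀ L → 2 ℕ.* L ≡ L ℕ.+ L
double L = cong (L ℕ.+_) (ℕP.+-identityʳ L)

zero-unless : ∀ {A B : ℕ} n → (0 < n → A ℕ.≤ B) → B < A → n ≡ 0
zero-unless zero _ _ = refl
zero-unless (suc n) high low = ⊥-elim (ℕP.<⇒≱ low (high (s≤s z≤n)))

partitionTerm : List ℕ → Term
partitionTerm lam = term (+ 1) (2 ℕ.* sum lam) (+ 0)

module Reduction (k : ℕ) (lam : List ℕ) (hs vs : List Bool)
                 (wd : weaklyDecreasing lam ≡ true) (inside : InsideStaircase k lam) where
  L = sum lam
  h = at false hs
  v = at false vs

  weight : (ℕ → ℕ) → (ℕ → ℕ) → Term
  weight rl cl = arrowWeight k rl cl hs vs

  W W₀ X : Term
  W  = weight (rowLen k lam) (colLen k lam)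
  W₀ = weight (λ r → k ∸ r) (λ c → k ∸ c)
  X  = mulTerm (partitionTerm lam) (wt k ([] , hs , vs))

  -- Arrow lengths at least those of δ_k/λ (true for δ_k/λ and for δ_k).
  LongRows LongCols : (ℕ → ℕ) → Set
  LongRows rl = ∀ r → rowLen k lam r ℕ.≤ rl r
  LongCols cl = ∀ c → colLen k lam c ℕ.≤ cl c

  -- An arrow in a row where λ is nonempty forces q-degree ≥ k: the row index
  -- and λ_r are both at most |λ|, and the arrow covers the rest of the row.
  rowArrow-high : ∀ rl cl → LongRows rl → ∀ r → r < k → h r ≡ true → 0 < at 0 lam r →
                  k ℕ.≤ 2 ℕ.* L ℕ.+ qe (weight rl cl)
  rowArrow-high rl cl long r r<k hr pos = ℕP.≤-trans
    (reach (r ℕ.+ at 0 lam r) L k (subst (r ℕ.+ at 0 lam r ℕ.≤_) (sym (double L))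
      (ℕP.+-mono-≤ (ℕP.<⇒≤ (nonemptyRow<size lam r wd pos)) (part≤size lam r))))
    (ℕP.+-monoʳ-≤ (2 ℕ.* L) (ℕP.≤-trans (ℕP.≤-reflexive (sym (ℕP.∸-+-assoc k r (at 0 lam r))))
      (ℕP.≤-trans (long r) (ℕP.≤-trans (sumWhere-≥ h rl k r r<k hr) (ℕP.m≤m+n _ _)))))

  colArrow-high : ∀ rl cl → LongCols cl → ∀ c → c < k → v c ≡ true → 0 < conj lam c →
                  k ℕ.≤ 2 ℕ.* L ℕ.+ qe (weight rl cl)
  colArrow-high rl cl long c c<k vc pos = ℕP.≤-trans
    (reach (c ℕ.+ conj lam c) L k (subst (c ℕ.+ conj lam c ℕ.≤_) (sym (double L))
      (ℕP.+-mono-≤ (ℕP.<⇒≤ (nonemptyCol<size lam c pos)) (conj≤size lam c))))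
    (ℕP.+-monoʳ-≤ (2 ℕ.* L) (ℕP.≤-trans (ℕP.≤-reflexive (sym (ℕP.∸-+-assoc k c (conj lam c))))
      (ℕP.≤-trans (long c) (ℕP.≤-trans (sumWhere-≥ v cl k c c<k vc) (ℕP.m≤n+m _ _)))))

  -- Hence in degree < k all arrows avoid λ, and the weight is that of δ_k.
  low⇒W≡W₀ : ∀ rl cl → LongRows rl → LongCols cl → 2 ℕ.* L ℕ.+ qe (weight rl cl) < k → W ≡ W₀
  low⇒W≡W₀ rl cl longR longC low = arrowWeight-cong k _ _ _ _ hs vs
    (λ r r<k hr → cong ((k ∸ r) ∸_) (zero-unless (at 0 lam r) (rowArrow-high rl cl longR r r<k hr) low))
    (λ c c<k vc → cong ((k ∸ c) ∸_) (zero-unless (conj lam c) (colArrow-high rl cl longC c c<k vc) low))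

  -- Two arrows through the corner (r, λ_r) of δ_k already cover k cells,
  -- since r + λ_r < k.
  corner-high : ∀ r → r < k → h r ≡ true → v (at 0 lam r) ≡ true → k ℕ.≤ qe W₀
  corner-high r r<k hr vλ = ℕP.≤-trans (ℕP.≤-reflexive (sym (ℕP.m∸n+n≡m (ℕP.<⇒≤ r<k))))
    (ℕP.+-mono-≤ (sumWhere-≥ h (λ r → k ∸ r) k r r<k hr)
      (ℕP.≤-trans (ℕP.m+n≤o⇒m≤o∸n r (ℕP.≤-trans (ℕP.≤-reflexive (ℕP.+-comm r _)) (ℕP.<⇒≤ (inside r r<k))))
        (sumWhere-≥ v (λ c → k ∸ c) k (at 0 lam r) (ℕP.≤-<-trans (ℕP.m≤m+n _ r) (inside r r<k)) vλ)))

  low⇒cornersOK : 2 ℕ.* L ℕ.+ qe W₀ < k → cornersOK k (lam , hs , vs) ≡ true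
  low⇒cornersOK low = and-applyUpTo (λ x → x) k _ noDoubleCorner
    where
    noDoubleCorner : ∀ r → r < k → not (addableRow lam r ∧ (h r ∧ v (at 0 lam r))) ≡ true
    noDoubleCorner r r<k with h r in hr | v (at 0 lam r) in vλ
    ... | true  | true  = ⊥-elim (ℕP.<⇒≱ low (ℕP.≤-trans (corner-high r r<k hr vλ) (ℕP.m≤n+m (qe W₀) (2 ℕ.* L))))
    ... | true  | false = cong not (∧-zeroʳ (addableRow lam r))
    ... | false | _     = cong not (∧-zeroʳ (addableRow lam r))

  -- The term of (λ , A) agrees below q^k with q^{2|λ|} · wt(∅ , A), the corner
  -- condition included: both have degree ≥ k unless A avoids λ.
  reduction : ∀ j m → j < k →
    (if cornersOK k (lam , hs , vs) then contrib j m (wt k (lam , hs , vs)) else + 0)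
      ≡ contrib j m X
  reduction j m j<k with 2 ℕ.* L ℕ.+ qe W₀ ℕ.<? k
  ... | yes low = trans (if-true (low⇒cornersOK low))
          (contrib-cong j m {wt k (lam , hs , vs)} {X}
            (trans (cong c W≡W₀) (sym (ℤP.*-identityˡ _)))
            (cong (λ w → 2 ℕ.* L ℕ.+ qe w) W≡W₀)
            (trans (cong ye W≡W₀) (sym (ℤP.+-identityˡ _))))
    where
    W≡W₀ : W ≡ W₀
    W≡W₀ = low⇒W≡W₀ _ _ (λ r → ℕP.m∸n≤m (k ∸ r) (at 0 lam r)) (λ c → ℕP.m∸n≤m (k ∸ c) (conj lam c)) low
  ... | no high = trans (if-zero (cornersOK k (lam , hs , vs)) (contrib-high m (wt k (lam , hs , vs)) j<k W-high))
                        (sym (contrib-high m X j<k (ℕP.≮⇒≥ high)))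
    where
    W-high : k ℕ.≤ 2 ℕ.* L ℕ.+ qe W
    W-high with 2 ℕ.* L ℕ.+ qe W ℕ.<? k
    ... | no high' = ℕP.≮⇒≥ high'
    ... | yes low = ⊥-elim (high (subst (λ w → 2 ℕ.* L ℕ.+ qe w < k)
                      (low⇒W≡W₀ _ _ (λ _ → ℕP.≤-refl) (λ _ → ℕP.≤-refl) low) low))

-- G_k = Σ_{λ ⊂ δ_{k-1}} q^{2|λ|}  and  W_k = Σ_A wt(∅ , A).
partitionSeries : ℕ → Poly
partitionSeries k = map partitionTerm (filterᵇ weaklyDecreasing (boundedLists (bounds k)))

emptyArrowSeries : ℕ → Poly
emptyArrowSeries k = concatMap (λ hs → map (λ vs → wt k ([] , hs , vs)) (boolLists k)) (boolLists k)

inside-cons : ∀ n x rest → x < suc n → InsideStaircase n rest → InsideStaircase (suc n) (x ∷ rest)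
inside-cons n x rest l b zero _ = subst (_< suc n) (sym (ℕP.+-identityʳ x)) l
inside-cons n x rest l b (suc r) (s≤s l') = subst (_< suc n) (sym (ℕP.+-suc _ r)) (s≤s (b r l'))

∑-boundedLists-cong : ∀ n {f g : List ℕ → ℤ} → (∀ lam → InsideStaircase n lam → f lam ≡ g lam) →
  ∑ (boundedLists (bounds n)) f ≡ ∑ (boundedLists (bounds n)) g
∑-boundedLists-cong zero e = cong (ℤ._+ + 0) (e [] (λ r ()))
∑-boundedLists-cong (suc n) {f} {g} e = begin
  ∑ (concatMap extend (upTo (suc n))) f   ≡⟨ ∑-concatMap extend (upTo (suc n)) f ⟩
  ∑ (upTo (suc n)) (λ x → ∑ (extend x) f) ≡⟨ ∑-applyUpTo-cong (λ x → x) (suc n) (λ x x≤n →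
                                              trans (∑-map (x ∷_) rests f) (trans
                                                (∑-boundedLists-cong n (λ rest b → e (x ∷ rest) (inside-cons n x rest x≤n b)))
                                                (sym (∑-map (x ∷_) rests g)))) ⟩
  ∑ (upTo (suc n)) (λ x → ∑ (extend x) g) ≡⟨ sym (∑-concatMap extend (upTo (suc n)) g) ⟩
  ∑ (concatMap extend (upTo (suc n))) g   ∎
  where
  open ≡-Reasoning
  rests = boundedLists (bounds n)
  extend : ℕ → List (List ℕ)
  extend x = map (x ∷_) rests

∑-candidates : ∀ k (F : Config → ℤ) →
  ∑ (candidates k) F ≡ ∑ (boundedLists (bounds k)) (λ lam → ∑ (boolLists k) (λ hs → ∑ (boolLists k) (λ vs → F (lam , hs , vs))))
∑-candidates k F = trans (∑-concatMap _ (boundedLists (bounds k)) F) (∑-cong (boundedLists (bounds k)) (λ lam →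
  trans (∑-concatMap _ (boolLists k) F) (∑-cong (boolLists k) (λ hs → ∑-map (λ vs → lam , hs , vs) (boolLists k) F))))

⟦partition⊗arrows⟧ : ∀ k j m → ⟦ partitionSeries k ⊗ emptyArrowSeries k ⟧ j m ≡
  ∑ (boundedLists (bounds k)) (λ lam → if weaklyDecreasing lam
     then ∑ (boolLists k) (λ hs → ∑ (boolLists k) (λ vs → contrib j m (mulTerm (partitionTerm lam) (wt k ([] , hs , vs)))))
     else + 0)
⟦partition⊗arrows⟧ k j m = begin
  ⟦ partitionSeries k ⊗ emptyArrowSeries k ⟧ j m
    ≡⟨ trans (∑-⊗ (partitionSeries k) (emptyArrowSeries k) (contrib j m)) (∑-map partitionTerm (filterᵇ weaklyDecreasing BL) _) ⟩
  ∑ (filterᵇ weaklyDecreasing BL) (λ lam → ∑ (emptyArrowSeries k) (H lam))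
    ≡⟨ ∑-filter weaklyDecreasing BL _ ⟩
  ∑ BL (λ lam → if weaklyDecreasing lam then ∑ (emptyArrowSeries k) (H lam) else + 0)
    ≡⟨ ∑-cong BL (λ lam → cong (λ z → if weaklyDecreasing lam then z else + 0)
         (trans (∑-concatMap _ B (H lam)) (∑-cong B (λ hs → ∑-map (λ vs → wt k ([] , hs , vs)) B (H lam))))) ⟩
  ∑ BL (λ lam → if weaklyDecreasing lam then ∑ B (λ hs → ∑ B (λ vs → H lam (wt k ([] , hs , vs)))) else + 0) ∎
  where
  open ≡-Reasoning
  BL = boundedLists (bounds k)
  B = boolLists k
  H : List ℕ → Term → ℤ
  H lam b = contrib j m (mulTerm (partitionTerm lam) b)

lhs≈partition⊗arrows : ∀ k → lhs k ≈[ k ] partitionSeries k ⊗ emptyArrowSeries k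
lhs≈partition⊗arrows k = ≈k-intro λ j m j<k → begin
  ⟦ lhs k ⟧ j m
    ≡⟨ trans (∑-map (wt k) (filterᵇ (inΔ⁺ k) (candidates k)) (contrib j m)) (∑-filter (inΔ⁺ k) (candidates k) _) ⟩
  ∑ (candidates k) (λ C → if inΔ⁺ k C then contrib j m (wt k C) else + 0)
    ≡⟨ ∑-candidates k _ ⟩
  ∑ BL (λ lam → ∑ B (λ hs → ∑ B (λ vs → if inΔ⁺ k (lam , hs , vs) then contrib j m (wt k (lam , hs , vs)) else + 0)))
    ≡⟨ ∑-boundedLists-cong k (λ lam inside → perPartition j m j<k lam inside (weaklyDecreasing lam) refl) ⟩
  ∑ BL (λ lam → if weaklyDecreasing lam
     then ∑ B (λ hs → ∑ B (λ vs → contrib j m (mulTerm (partitionTerm lam) (wt k ([] , hs , vs)))))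
     else + 0)
    ≡⟨ sym (⟦partition⊗arrows⟧ k j m) ⟩
  ⟦ partitionSeries k ⊗ emptyArrowSeries k ⟧ j m ∎
  where
  open ≡-Reasoning
  BL = boundedLists (bounds k)
  B = boolLists k
  perPartition : ∀ j m → j < k → ∀ lam → InsideStaircase k lam → ∀ b → weaklyDecreasing lam ≡ b →
    ∑ B (λ hs → ∑ B (λ vs → if b ∧ cornersOK k (lam , hs , vs) then contrib j m (wt k (lam , hs , vs)) else + 0))
    ≡ (if b then ∑ B (λ hs → ∑ B (λ vs → contrib j m (mulTerm (partitionTerm lam) (wt k ([] , hs , vs))))) else + 0)
  perPartition j m j<k lam inside false _ = trans (∑-cong B (λ _ → ∑-0 B)) (∑-0 B)
  perPartition j m j<k lam inside true wd = ∑-cong B (λ hs → ∑-cong B (λ vs →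
    Reduction.reduction k lam hs vs wd inside j m j<k))

-- Step (2): the arrow series W_k factorises over rows and columns.

sgn-suc : ∀ b → sgn (suc b) ≡ ℤ.- sgn b
sgn-suc zero = refl
sgn-suc (suc zero) = refl
sgn-suc (suc (suc b)) = sgn-suc b

sgn-+ : ∀ a b → sgn (a ℕ.+ b) ≡ sgn a ℤ.* sgn b
sgn-+ zero b = sym (ℤP.*-identityˡ (sgn b))
sgn-+ (suc zero) b = trans (sgn-suc b) (sym (ℤP.-1*i≡-i (sgn b)))
sgn-+ (suc (suc a)) b = sgn-+ a b

sgn-∣-∣ : ∀ a b → sgn ℤ.∣ + a ℤ.- + b ∣ ≡ sgn (a ℕ.+ b)
sgn-∣-∣ a zero = trans (cong (sgn ∘ ℤ.∣_∣) (ℤP.+-identityʳ (+ a))) (cong sgn (sym (ℕP.+-identityʳ a)))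
sgn-∣-∣ zero (suc b) = refl
sgn-∣-∣ (suc a) (suc b) = begin
  sgn ℤ.∣ + suc a ℤ.- + suc b ∣ ≡⟨ cong (sgn ∘ ℤ.∣_∣) (trans (ℤP.[+m]-[+n]≡m⊖n (suc a) (suc b))
                                     (trans (ℤP.[1+m]⊖[1+n]≡m⊖n a b) (sym (ℤP.[+m]-[+n]≡m⊖n a b)))) ⟩
  sgn ℤ.∣ + a ℤ.- + b ∣          ≡⟨ sgn-∣-∣ a b ⟩
  sgn (a ℕ.+ b)                   ≡⟨ cong sgn (sym (ℕP.+-suc (suc a) b)) ⟩
  sgn (suc a ℕ.+ suc b)           ∎
  where open ≡-Reasoning

-- The monomial (-1)^P (-1)^O q^Q y^{s O} of a family of P arrows, O of them of
-- odd length, of total length Q; the y-exponent is s O (s = ±id).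
signedTerm : (ℕ → ℤ) → ℕ → ℕ → ℕ → Term
signedTerm s P O Q = term (sgn P ℤ.* sgn O) Q (s O)

signedTerm-+ : ∀ (s : ℕ → ℤ) → (∀ a b → s (a ℕ.+ b) ≡ s a ℤ.+ s b) → ∀ P O Q P' O' Q' →
  signedTerm s (P ℕ.+ P') (O ℕ.+ O') (Q ℕ.+ Q') ≡ mulTerm (signedTerm s P O Q) (signedTerm s P' O' Q')
signedTerm-+ s additive P O Q P' O' Q' = cong₂ (λ x y → term x (Q ℕ.+ Q') y)
  (trans (cong₂ ℤ._*_ (sgn-+ P P') (sgn-+ O O')) (interchange (sgn P) (sgn P') (sgn O) (sgn O')))
  (additive O O')
  where
  interchange : ∀ a b c d → (a ℤ.* b) ℤ.* (c ℤ.* d) ≡ (a ℤ.* c) ℤ.* (b ℤ.* d)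
  interchange = solve-∀

-- Weight of the arrows on one side (the rows, or the columns): bs marks the
-- lines 0..n-1 carrying an arrow, f gives their lengths.
sideWeight : (ℕ → ℤ) → (ℕ → ℕ) → ℕ → List Bool → Term
sideWeight s f n bs = signedTerm s (countWhere (at false bs) n)
  (countWhere (λ r → at false bs r ∧ odd (f r)) n) (sumWhere (at false bs) f n)

negs : ℕ → ℤ
negs o = ℤ.- (+ o)

-- For λ = ∅ the weight is the product of the row and the column weights;
-- horizontal odd arrows count y, vertical ones y⁻¹.
emptyWeight-split : ∀ k hs vs →
  wt k ([] , hs , vs) ≡ mulTerm (sideWeight +_ (k ∸_) k hs) (sideWeight negs (k ∸_) k vs)
emptyWeight-split k hs vs = cong (λ z → term z (sumWhere (at false hs) (k ∸_) k ℕ.+ sumWhere (at false vs) (k ∸_) k) (+ oh ℤ.- + ov))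
  (trans (cong₂ ℤ._*_ (sgn-+ nh nv) (trans (sgn-∣-∣ oh ov) (sgn-+ oh ov))) (interchange (sgn nh) (sgn nv) (sgn oh) (sgn ov)))
  where
  nh = countWhere (at false hs) k
  nv = countWhere (at false vs) k
  oh = countWhere (λ r → at false hs r ∧ odd (k ∸ r)) k
  ov = countWhere (λ r → at false vs r ∧ odd (k ∸ r)) k
  interchange : ∀ a b c d → (a ℤ.* b) ℤ.* (c ℤ.* d) ≡ (a ℤ.* c) ℤ.* (b ℤ.* d)
  interchange = solve-∀

emptyArrowSeries-split : ∀ k → emptyArrowSeries k ≈
  map (sideWeight +_ (k ∸_) k) (boolLists k) ⊗ map (sideWeight negs (k ∸_) k) (boolLists k)
emptyArrowSeries-split k = ≈-intro λ j m → begin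
  ⟦ emptyArrowSeries k ⟧ j m
    ≡⟨ trans (∑-concatMap _ B (contrib j m)) (∑-cong B (λ hs → ∑-map (λ vs → wt k ([] , hs , vs)) B (contrib j m))) ⟩
  ∑ B (λ hs → ∑ B (λ vs → contrib j m (wt k ([] , hs , vs))))
    ≡⟨ ∑-cong B (λ hs → ∑-cong B (λ vs → cong (contrib j m) (emptyWeight-split k hs vs))) ⟩
  ∑ B (λ hs → ∑ B (λ vs → contrib j m (mulTerm (rows hs) (cols vs))))
    ≡⟨ sym (trans (∑-⊗ (map rows B) (map cols B) (contrib j m)) (trans (∑-map rows B _) (∑-cong B (λ hs → ∑-map cols B _)))) ⟩
  ⟦ map rows B ⊗ map cols B ⟧ j m ∎
  where
  open ≡-Reasoning
  B = boolLists k
  rows = sideWeight +_ (k ∸_) k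
  cols = sideWeight negs (k ∸_) k

oddIndicator : ℕ → ℕ
oddIndicator L = if odd L then 1 else 0

singleArrow : (ℕ → ℤ) → ℕ → Term
singleArrow s L = signedTerm s 1 (oddIndicator L) L

noArrow : (ℕ → ℤ) → Term
noArrow s = signedTerm s 0 0 0

lineFactor : (ℕ → ℤ) → ℕ → Poly
lineFactor s L = noArrow s ∷ singleArrow s L ∷ []

lineProduct : (ℕ → ℤ) → (ℕ → ℕ) → ℕ → Poly
lineProduct s f zero = one
lineProduct s f (suc n) = lineFactor s (f 0) ⊗ lineProduct s (f ∘ suc) n

sum-upTo-suc : ∀ n (F : ℕ → ℕ) → sum (map F (upTo (suc n))) ≡ F 0 ℕ.+ sum (map (F ∘ suc) (upTo n))
sum-upTo-suc n F = cong (F 0 ℕ.+_) (cong sum (trans (LP.map-applyUpTo suc F n) (sym (LP.map-applyUpTo (λ x → x) (F ∘ suc) n))))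

signedTerm-cong : ∀ s {P P' O O' Q Q'} → P ≡ P' → O ≡ O' → Q ≡ Q' → signedTerm s P O Q ≡ signedTerm s P' O' Q'
signedTerm-cong s refl refl refl = refl

sideWeight-step : ∀ (s : ℕ → ℤ) → (∀ a b → s (a ℕ.+ b) ≡ s a ℤ.+ s b) → ∀ f n b bs →
  sideWeight s f (suc n) (b ∷ bs) ≡ mulTerm (if b then singleArrow s (f 0) else noArrow s) (sideWeight s (f ∘ suc) n bs)
sideWeight-step s additive f n b bs = begin
  sideWeight s f (suc n) (b ∷ bs)
    ≡⟨ signedTerm-cong s (sum-upTo-suc n (λ i → if at false (b ∷ bs) i then 1 else 0))
                         (sum-upTo-suc n (λ i → if at false (b ∷ bs) i ∧ odd (f i) then 1 else 0))
                         (sum-upTo-suc n (λ i → if at false (b ∷ bs) i then f i else 0)) ⟩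
  signedTerm s (count b ℕ.+ countWhere (at false bs) n) (countOdd b ℕ.+ countWhere (λ r → at false bs r ∧ odd (f (suc r))) n)
               (length b ℕ.+ sumWhere (at false bs) (f ∘ suc) n)
    ≡⟨ signedTerm-+ s additive (count b) (countOdd b) (length b) _ _ _ ⟩
  mulTerm (signedTerm s (count b) (countOdd b) (length b)) (sideWeight s (f ∘ suc) n bs)
    ≡⟨ cong (λ t → mulTerm t (sideWeight s (f ∘ suc) n bs)) (first b) ⟩
  mulTerm (if b then singleArrow s (f 0) else noArrow s) (sideWeight s (f ∘ suc) n bs) ∎
  where
  open ≡-Reasoning
  count countOdd length : Bool → ℕ
  count b = if b then 1 else 0
  countOdd b = if b ∧ odd (f 0) then 1 else 0
  length b = if b then f 0 else 0
  first : ∀ b → signedTerm s (count b) (countOdd b) (length b) ≡ (if b then singleArrow s (f 0) else noArrow s)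
  first true = refl
  first false = refl

sideSeries≈lineProduct : ∀ (s : ℕ → ℤ) → s 0 ≡ + 0 → (∀ a b → s (a ℕ.+ b) ≡ s a ℤ.+ s b) → ∀ f n →
  map (sideWeight s f n) (boolLists n) ≈ lineProduct s f n
sideSeries≈lineProduct s s0 additive f zero = ≈-intro λ j m →
  cong (ℤ._+ + 0) (contrib-cong j m {sideWeight s f zero []} {term (+ 1) 0 (+ 0)} refl refl s0)
sideSeries≈lineProduct s s0 additive f (suc n) =
  ≈-trans (≈-intro peel) (⊗-congʳ (lineFactor s (f 0)) (sideSeries≈lineProduct s s0 additive (f ∘ suc) n))
  where
  rest = map (sideWeight s (f ∘ suc) n) (boolLists n)
  peel : ∀ j m → ⟦ map (sideWeight s f (suc n)) (boolLists (suc n)) ⟧ j m ≡ ⟦ lineFactor s (f 0) ⊗ rest ⟧ j m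
  peel j m = begin
    ⟦ map (sideWeight s f (suc n)) (boolLists (suc n)) ⟧ j m
      ≡⟨ trans (∑-map (sideWeight s f (suc n)) (boolLists (suc n)) _) (∑-concatMap _ (boolLists n) _) ⟩
    ∑ (boolLists n) (λ bs → withArrow bs ℤ.+ (noArrowAt bs ℤ.+ + 0))
      ≡⟨ ∑-cong (boolLists n) (λ bs → trans (cong (ℤ._+_ (withArrow bs)) (ℤP.+-identityʳ _))
                                            (ℤP.+-comm (withArrow bs) (noArrowAt bs))) ⟩
    ∑ (boolLists n) (λ bs → noArrowAt bs ℤ.+ withArrow bs)
      ≡⟨ ∑-cong (boolLists n) (λ bs → cong₂ ℤ._+_ (cong (contrib j m) (sideWeight-step s additive f n false bs))
                                                  (cong (contrib j m) (sideWeight-step s additive f n true bs))) ⟩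
    ∑ (boolLists n) (λ bs → contrib j m (mulTerm (noArrow s) (sideWeight s (f ∘ suc) n bs))
                            ℤ.+ contrib j m (mulTerm (singleArrow s (f 0)) (sideWeight s (f ∘ suc) n bs)))
      ≡⟨ ∑-+ (boolLists n) _ _ ⟩
    ∑ (boolLists n) (λ bs → contrib j m (mulTerm (noArrow s) (sideWeight s (f ∘ suc) n bs)))
      ℤ.+ ∑ (boolLists n) (λ bs → contrib j m (mulTerm (singleArrow s (f 0)) (sideWeight s (f ∘ suc) n bs)))
      ≡⟨ sym (trans (∑-⊗ (lineFactor s (f 0)) rest (contrib j m))
               (cong₂ ℤ._+_ (∑-map _ (boolLists n) _) (trans (ℤP.+-identityʳ _) (∑-map _ (boolLists n) _)))) ⟩
    ⟦ lineFactor s (f 0) ⊗ rest ⟧ j m ∎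
    where
    open ≡-Reasoning
    withArrow noArrowAt : List Bool → ℤ
    withArrow bs = contrib j m (sideWeight s f (suc n) (true ∷ bs))
    noArrowAt bs = contrib j m (sideWeight s f (suc n) (false ∷ bs))

staircaseSide : (ℕ → ℤ) → ℕ → Poly
staircaseSide s n = lineProduct s (n ∸_) n

-- Lines of length ≥ k do not matter modulo q^k.
staircaseSide-trunc : ∀ s → s 0 ≡ + 0 → ∀ k d → staircaseSide s (d ℕ.+ k) ≈[ k ] staircaseSide s k
staircaseSide-trunc s s0 k zero = ≈k-refl
staircaseSide-trunc s s0 k (suc d) =
  staircaseSide s (suc d ℕ.+ k)
    ≈k⟨ ⊗-congˡk (staircaseSide s (d ℕ.+ k)) (drop-high (noArrow s) (singleArrow s (suc d ℕ.+ k)) (ℕP.m≤n+m k (suc d))) ⟩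
  [ noArrow s ] ⊗ staircaseSide s (d ℕ.+ k)
    ≈⟨ subst (λ y → [ term (+ 1) 0 y ] ⊗ staircaseSide s (d ℕ.+ k) ≈ staircaseSide s (d ℕ.+ k)) (sym s0)
         (⊗-identityˡ (staircaseSide s (d ℕ.+ k))) ⟩
  staircaseSide s (d ℕ.+ k)
    ≈k⟨ staircaseSide-trunc s s0 k d ⟩
  staircaseSide s k ∎k

evenFactor oddFactor⁺ oddFactor⁻ : ℕ → Poly
evenFactor n = term (+ 1) 0 (+ 0) ∷ term (ℤ.- (+ 1)) (2 ℕ.* n ℕ.+ 2) (+ 0) ∷ []
oddFactor⁺ n = term (+ 1) 0 (+ 0) ∷ term (+ 1) (2 ℕ.* n ℕ.+ 1) (+ 1) ∷ []
oddFactor⁻ n = term (+ 1) 0 (+ 0) ∷ term (+ 1) (2 ℕ.* n ℕ.+ 1) (ℤ.- (+ 1)) ∷ []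

eulerProduct : ℕ → Poly
eulerProduct zero = one
eulerProduct (suc n) = eulerProduct n ⊗ evenFactor n

twice : ℕ → ℕ
twice zero = zero
twice (suc n) = suc (suc (twice n))

twice≡+ : ∀ n → n ℕ.+ n ≡ twice n
twice≡+ zero = refl
twice≡+ (suc n) = cong suc (trans (ℕP.+-suc n n) (cong suc (twice≡+ n)))

twice≡2* : ∀ n → twice n ≡ 2 ℕ.* n
twice≡2* n = trans (sym (twice≡+ n)) (sym (double n))

odd-suc-suc : ∀ L → odd (suc (suc L)) ≡ odd L
odd-suc-suc L = cong (λ x → not (x ≡ᵇ 0)) (trans (ℕD.%-congˡ (ℕP.+-comm 2 L)) (ℕD.[m+n]%n≡m%n L 2))

odd-twice : ∀ n → odd (twice n) ≡ false
odd-twice zero = refl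
odd-twice (suc n) = trans (odd-suc-suc (twice n)) (odd-twice n)

odd-suc-twice : ∀ n → odd (suc (twice n)) ≡ true
odd-suc-twice zero = refl
odd-suc-twice (suc n) = trans (odd-suc-suc (suc (twice n))) (odd-suc-twice n)

lineFactor-even : ∀ s → s 0 ≡ + 0 → ∀ n → lineFactor s (twice (suc n)) ≡ evenFactor n
lineFactor-even s s0 n rewrite odd-twice (suc n) | s0 =
  cong (λ L → term (+ 1) 0 (+ 0) ∷ term (ℤ.- (+ 1)) L (+ 0) ∷ [])
       (trans (twice≡2* (suc n)) (trans (ℕP.*-suc 2 n) (ℕP.+-comm 2 (2 ℕ.* n))))

lineFactor-odd : ∀ s → s 0 ≡ + 0 → ∀ n →
  lineFactor s (suc (twice n)) ≡ term (+ 1) 0 (+ 0) ∷ term (+ 1) (2 ℕ.* n ℕ.+ 1) (s 1) ∷ []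
lineFactor-odd s s0 n rewrite odd-suc-twice n | s0 =
  cong (λ L → term (+ 1) 0 (+ 0) ∷ term (+ 1) L (s 1) ∷ [])
       (trans (cong suc (twice≡2* n)) (ℕP.+-comm 1 (2 ℕ.* n)))

-- Pairing the two sides of δ_{2n}: the lines of lengths 2i-1 give the odd
-- factors, those of length 2i give (1 - q^{2i}) twice.
staircase-pairing : ∀ n →
  staircaseSide +_ (twice n) ⊗ staircaseSide negs (twice n) ≈ prodUpTo n ⊗ eulerProduct n
staircase-pairing zero = ⊗-identityˡ one
staircase-pairing (suc n) = ≈k⇒≈ λ k →
  (lineFactor +_ (twice (suc n)) ⊗ (lineFactor +_ (suc (twice n)) ⊗ Rows))
    ⊗ (lineFactor negs (twice (suc n)) ⊗ (lineFactor negs (suc (twice n)) ⊗ Cols))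
    ≈⟨ ≈-reflexive (cong₂ _⊗_
         (cong₂ (λ a b → a ⊗ (b ⊗ Rows)) (lineFactor-even +_ refl n) (lineFactor-odd +_ refl n))
         (cong₂ (λ a b → a ⊗ (b ⊗ Cols)) (lineFactor-even negs refl n) (lineFactor-odd negs refl n))) ⟩
  (E ⊗ (O⁺ ⊗ Rows)) ⊗ (E ⊗ (O⁻ ⊗ Cols))
    ≈⟨ ⊗-Solver.solve 5 (λ e o⁺ o⁻ x y → (e ⊕ (o⁺ ⊕ x)) ⊕ (e ⊕ (o⁻ ⊕ y)) ⊜ (x ⊕ y) ⊕ (e ⊕ (e ⊕ (o⁺ ⊕ o⁻))))
         ≈-refl E O⁺ O⁻ Rows Cols ⟩
  (Rows ⊗ Cols) ⊗ (E ⊗ (E ⊗ (O⁺ ⊗ O⁻)))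
    ≈⟨ ⊗-congˡ (E ⊗ (E ⊗ (O⁺ ⊗ O⁻))) (staircase-pairing n) ⟩
  (prodUpTo n ⊗ eulerProduct n) ⊗ (E ⊗ (E ⊗ (O⁺ ⊗ O⁻)))
    ≈⟨ ⊗-Solver.solve 5 (λ e o⁺ o⁻ x y → (x ⊕ y) ⊕ (e ⊕ (e ⊕ (o⁺ ⊕ o⁻))) ⊜ (x ⊕ (e ⊕ (o⁺ ⊕ o⁻))) ⊕ (y ⊕ e))
                      ≈-refl E O⁺ O⁻ (prodUpTo n) (eulerProduct n) ⟩
  prodUpTo (suc n) ⊗ eulerProduct (suc n) ∎k
  where
  Rows = staircaseSide +_ (twice n)
  Cols = staircaseSide negs (twice n)
  E = evenFactor n
  O⁺ = oddFactor⁺ n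
  O⁻ = oddFactor⁻ n

-- Step (2):  W_k ≡ Π_{i≤k} (1+yq^{2i-1})(1+y⁻¹q^{2i-1})(1-q^{2i}) · Π_{i≤k} (1-q^{2i})  mod q^k,
-- computed on δ_{2k}, which agrees with δ_k below q^k.
arrowSeries≈products : ∀ k → emptyArrowSeries k ≈[ k ] prodUpTo k ⊗ eulerProduct k
arrowSeries≈products k =
  emptyArrowSeries k
    ≈⟨ ≈-trans (emptyArrowSeries-split k) (⊗-cong (sideSeries≈lineProduct +_ refl ℤP.pos-+ (k ∸_) k)
                                                   (sideSeries≈lineProduct negs refl negs-+ (k ∸_) k)) ⟩
  staircaseSide +_ k ⊗ staircaseSide negs k
    ≈k⟨ ≈k-sym (⊗-congk (staircaseSide-trunc +_ refl k k) (staircaseSide-trunc negs refl k k)) ⟩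
  staircaseSide +_ (k ℕ.+ k) ⊗ staircaseSide negs (k ℕ.+ k)
    ≈⟨ subst (λ n → staircaseSide +_ n ⊗ staircaseSide negs n ≈ prodUpTo k ⊗ eulerProduct k)
             (sym (twice≡+ k)) (staircase-pairing k) ⟩
  prodUpTo k ⊗ eulerProduct k ∎k
  where
  negs-+ : ∀ a b → negs (a ℕ.+ b) ≡ negs a ℤ.+ negs b
  negs-+ a b = trans (cong ℤ.-_ (ℤP.pos-+ a b)) (ℤP.neg-distrib-+ (+ a) (+ b))

-- Step (3): Euler's identity  Π_{i≤x} (1 - q^{2i}) · Σ_{λ_0 ≤ x} q^{2|λ|} ≡ 1.

evenPower : ℕ → Term
evenPower y = term (+ 1) (2 ℕ.* y) (+ 0)

-- Partitions in the box of the staircase with n rows whose largest part is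
-- at most x.
cappedPartitions : ℕ → ℕ → Poly
cappedPartitions n x = map partitionTerm (filterᵇ (λ lam → weaklyDecreasing (x ∷ lam)) (boundedLists (bounds n)))

partitionTerm-cons : ∀ y rest → partitionTerm (y ∷ rest) ≡ mulTerm (evenPower y) (partitionTerm rest)
partitionTerm-cons y rest = cong (λ e → term (+ 1) e (+ 0)) (ℕP.*-distribˡ-+ 2 y (sum rest))

-- q^{2y} G(n, y): the partitions of the (n+1)-row box with largest part y.
withLargest : ℕ → ℕ → Poly
withLargest n y = [ evenPower y ] ⊗ cappedPartitions n y

cappedPartitions-byLargest : ∀ n x j m → ⟦ cappedPartitions (suc n) x ⟧ j m ≡
  ∑ (upTo (suc n)) (λ y → if y ≤ᵇ x then ⟦ withLargest n y ⟧ j m else + 0)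
cappedPartitions-byLargest n x j m = begin
  ⟦ cappedPartitions (suc n) x ⟧ j m
    ≡⟨ trans (∑-map partitionTerm (filterᵇ (λ lam → weaklyDecreasing (x ∷ lam)) (boundedLists (bounds (suc n)))) _)
             (∑-filter _ (boundedLists (bounds (suc n))) _) ⟩
  ∑ (concatMap extend (upTo (suc n))) F
    ≡⟨ ∑-concatMap extend (upTo (suc n)) F ⟩
  ∑ (upTo (suc n)) (λ y → ∑ (extend y) F)
    ≡⟨ ∑-cong (upTo (suc n)) (λ y → trans (∑-map (y ∷_) rests F) (largest y (y ≤ᵇ x))) ⟩
  ∑ (upTo (suc n)) (λ y → if y ≤ᵇ x then ∑ rests (H y) else + 0)
    ≡⟨ ∑-cong (upTo (suc n)) (λ y → cong (λ z → if y ≤ᵇ x then z else + 0) (sym (shifted y))) ⟩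
  ∑ (upTo (suc n)) (λ y → if y ≤ᵇ x then ⟦ withLargest n y ⟧ j m else + 0) ∎
  where
  open ≡-Reasoning
  rests = boundedLists (bounds n)
  extend : ℕ → List (List ℕ)
  extend y = map (y ∷_) rests
  F : List ℕ → ℤ
  F lam = if weaklyDecreasing (x ∷ lam) then contrib j m (partitionTerm lam) else + 0
  -- weaklyDecreasing (x ∷ y ∷ rest) = (y ≤ᵇ x) ∧ weaklyDecreasing (y ∷ rest)
  H : ℕ → List ℕ → ℤ
  H y rest = if weaklyDecreasing (y ∷ rest) then contrib j m (mulTerm (evenPower y) (partitionTerm rest)) else + 0
  largest : ∀ y b →
    ∑ rests (λ rest → if b ∧ weaklyDecreasing (y ∷ rest) then contrib j m (partitionTerm (y ∷ rest)) else + 0)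
      ≡ (if b then ∑ rests (H y) else + 0)
  largest y false = ∑-0 rests
  largest y true = ∑-cong rests (λ rest →
    cong (λ t → if weaklyDecreasing (y ∷ rest) then contrib j m t else + 0) (partitionTerm-cons y rest))
  shifted : ∀ y → ⟦ withLargest n y ⟧ j m ≡ ∑ rests (H y)
  shifted y = trans (∑-⊗ [ evenPower y ] (cappedPartitions n y) (contrib j m)) (trans (ℤP.+-identityʳ _)
    (trans (∑-map partitionTerm (filterᵇ (λ rest → weaklyDecreasing (y ∷ rest)) rests) _)
           (∑-filter (λ rest → weaklyDecreasing (y ∷ rest)) rests _)))

raiseCap-newIndex : ∀ N x (F : ℕ → ℤ) →
  (if suc x <ᵇ N then F (suc x) else + 0) ℤ.+ (if N ≤ᵇ suc x then F N else + 0)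
    ≡ (if N ≤ᵇ x then F N else + 0) ℤ.+ (if suc x <ᵇ suc N then F (suc x) else + 0)
raiseCap-newIndex N x F with ℕP.<-cmp N (suc x)
... | tri< N<x+1 _ _ rewrite <ᵇ-no {suc x} {N} (ℕP.<⇒≤ N<x+1) | ≤ᵇ-yes (ℕP.<⇒≤ N<x+1)
                           | ≤ᵇ-yes (ℕP.≤-pred N<x+1) | <ᵇ-no {suc x} {suc N} N<x+1 = ℤP.+-comm (+ 0) (F N)
... | tri≈ _ refl _ rewrite <ᵇ-no {x} {x} ℕP.≤-refl | <ᵇ-yes {x} {suc x} ℕP.≤-refl = refl
... | tri> _ _ x+1<N rewrite <ᵇ-yes x+1<N | ≤ᵇ-no x+1<N | ≤ᵇ-no (ℕP.<-trans (ℕP.n<1+n x) x+1<N)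
                           | <ᵇ-yes {suc x} {suc N} (ℕP.m<n⇒m<1+n x+1<N) = ℤP.+-comm (F (suc x)) (+ 0)

∑-raiseCap : ∀ N x (F : ℕ → ℤ) → ∑ (upTo N) (λ y → if y ≤ᵇ suc x then F y else + 0)
  ≡ ∑ (upTo N) (λ y → if y ≤ᵇ x then F y else + 0) ℤ.+ (if suc x <ᵇ N then F (suc x) else + 0)
∑-raiseCap zero x F = refl
∑-raiseCap (suc N) x F = begin
  ∑ (upTo (suc N)) (capped (suc x))
    ≡⟨ trans (∑-upTo-suc N (capped (suc x))) (cong (ℤ._+ capped (suc x) N) (∑-raiseCap N x F)) ⟩
  ∑ (upTo N) (capped x) ℤ.+ extra N ℤ.+ capped (suc x) N
    ≡⟨ ℤP.+-assoc (∑ (upTo N) (capped x)) _ _ ⟩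
  ∑ (upTo N) (capped x) ℤ.+ (extra N ℤ.+ capped (suc x) N)
    ≡⟨ cong (ℤ._+_ (∑ (upTo N) (capped x))) (raiseCap-newIndex N x F) ⟩
  ∑ (upTo N) (capped x) ℤ.+ (capped x N ℤ.+ extra (suc N))
    ≡⟨ sym (trans (cong (ℤ._+ extra (suc N)) (∑-upTo-suc N (capped x))) (ℤP.+-assoc (∑ (upTo N) (capped x)) _ _)) ⟩
  ∑ (upTo (suc N)) (capped x) ℤ.+ extra (suc N) ∎
  where
  open ≡-Reasoning
  capped : ℕ → ℕ → ℤ
  capped b y = if y ≤ᵇ b then F y else + 0
  extra : ℕ → ℤ
  extra M = if suc x <ᵇ M then F (suc x) else + 0

⟦if⟧ : ∀ (b : Bool) p j m → ⟦ if b then p else [] ⟧ j m ≡ (if b then ⟦ p ⟧ j m else + 0)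
⟦if⟧ true p j m = refl
⟦if⟧ false p j m = refl

cappedPartitions-raise : ∀ n x → cappedPartitions (suc n) (suc x) ≈
  cappedPartitions (suc n) x ++ (if suc x <ᵇ suc n then withLargest n (suc x) else [])
cappedPartitions-raise n x = ≈-intro λ j m → begin
  ⟦ cappedPartitions (suc n) (suc x) ⟧ j m
    ≡⟨ cappedPartitions-byLargest n (suc x) j m ⟩
  ∑ (upTo (suc n)) (λ y → if y ≤ᵇ suc x then ⟦ withLargest n y ⟧ j m else + 0)
    ≡⟨ ∑-raiseCap (suc n) x (λ y → ⟦ withLargest n y ⟧ j m) ⟩
  ∑ (upTo (suc n)) (λ y → if y ≤ᵇ x then ⟦ withLargest n y ⟧ j m else + 0) ℤ.+ new j m
    ≡⟨ cong (ℤ._+ new j m) (sym (cappedPartitions-byLargest n x j m)) ⟩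
  ⟦ cappedPartitions (suc n) x ⟧ j m ℤ.+ new j m
    ≡⟨ sym (trans (⟦++⟧ (cappedPartitions (suc n) x) _ j m)
                  (cong (ℤ._+_ (⟦ cappedPartitions (suc n) x ⟧ j m)) (⟦if⟧ (suc x <ᵇ suc n) _ j m))) ⟩
  ⟦ cappedPartitions (suc n) x ++ (if suc x <ᵇ suc n then withLargest n (suc x) else []) ⟧ j m ∎
  where
  open ≡-Reasoning
  new : ℕ → ℤ → ℤ
  new j m = if suc x <ᵇ suc n then ⟦ withLargest n (suc x) ⟧ j m else + 0

cappedPartitions-inside : ∀ n x → x < n →
  cappedPartitions (suc n) (suc x) ≈ cappedPartitions (suc n) x ++ withLargest n (suc x)
cappedPartitions-inside n x x<n = ≈-trans (cappedPartitions-raise n x) (≈-reflexive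
  (cong (λ b → cappedPartitions (suc n) x ++ (if b then withLargest n (suc x) else [])) (<ᵇ-yes (s≤s x<n))))

cappedPartitions-outside : ∀ n x → n ℕ.≤ x → cappedPartitions (suc n) (suc x) ≈ cappedPartitions (suc n) x
cappedPartitions-outside n x n≤x = ≈-trans (cappedPartitions-raise n x) (≈-reflexive
  (trans (cong (λ b → cappedPartitions (suc n) x ++ (if b then withLargest n (suc x) else [])) (<ᵇ-no (s≤s n≤x)))
         (LP.++-identityʳ (cappedPartitions (suc n) x))))

cappedPartitions-cap0 : ∀ n → cappedPartitions n 0 ≈ one
cappedPartitions-cap0 zero = ≈-refl
cappedPartitions-cap0 (suc n) = ≈-trans (≈-intro onlyZero)
  (≈-trans (⊗-congʳ one (cappedPartitions-cap0 n)) (⊗-identityˡ one))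
  where
  onlyZero : ∀ j m → ⟦ cappedPartitions (suc n) 0 ⟧ j m ≡ ⟦ one ⊗ cappedPartitions n 0 ⟧ j m
  onlyZero j m = trans (cappedPartitions-byLargest n 0 j m)
    (trans (cong (ℤ._+_ (⟦ one ⊗ cappedPartitions n 0 ⟧ j m))
      (trans (∑-applyUpTo-cong suc n {g = λ _ → + 0} (λ i _ → refl)) (∑-0 (applyUpTo suc n))))
    (ℤP.+-identityʳ _))

evenFactor≈ : ∀ x → evenFactor x ≈ (one ++ neg [ evenPower (suc x) ])
evenFactor≈ x = ≈-reflexive (cong (λ e → term (+ 1) 0 (+ 0) ∷ term (ℤ.- (+ 1)) e (+ 0) ∷ [])
  (trans (ℕP.+-comm (2 ℕ.* x) 2) (sym (ℕP.*-suc 2 x))))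

-- Inductive step of Euler's identity when x+1 is an admissible part:
-- D_{x+1} G(n+1, x+1) = (1 - q^{2x+2}) D_x G(n+1, x) + q^{2x+2} D_{x+1} G(n, x+1).
euler-inside : ∀ n x → x < n →
  eulerProduct x ⊗ cappedPartitions (suc n) x ≈[ 2 ℕ.* suc n ] one →
  eulerProduct (suc x) ⊗ cappedPartitions n (suc x) ≈[ 2 ℕ.* n ] one →
  eulerProduct (suc x) ⊗ cappedPartitions (suc n) (suc x) ≈[ 2 ℕ.* suc n ] one
euler-inside n x x<n IH₁ IH₂ =
  (D ⊗ E) ⊗ cappedPartitions (suc n) (suc x)
    ≈⟨ ≈-trans (⊗-congʳ (D ⊗ E) (cappedPartitions-inside n x x<n)) (⊗-distribˡ (D ⊗ E) A (P ⊗ G)) ⟩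
  ((D ⊗ E) ⊗ A) ++ ((D ⊗ E) ⊗ (P ⊗ G))
    ≈⟨ ++-cong (≈-trans (⊗-Solver.solve 3 (λ d e a → (d ⊕ e) ⊕ a ⊜ (d ⊕ a) ⊕ e) ≈-refl D E A)
                 (≈-trans (⊗-congʳ (D ⊗ A) (evenFactor≈ x)) (⊗-distribˡ (D ⊗ A) one (neg P))))
               (⊗-Solver.solve 4 (λ d e p g → (d ⊕ e) ⊕ (p ⊕ g) ⊜ p ⊕ ((d ⊕ e) ⊕ g)) ≈-refl D E P G) ⟩
  (((D ⊗ A) ⊗ one) ++ ((D ⊗ A) ⊗ neg P)) ++ (P ⊗ ((D ⊗ E) ⊗ G))
    ≈k⟨ ++-congk (++-congk (⊗-congˡk one IH₁) (⊗-congˡk (neg P) IH₁)) (monomial-shift (evenPower (suc x)) shift IH₂) ⟩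
  ((one ⊗ one) ++ (one ⊗ neg P)) ++ (P ⊗ one)
    ≈⟨ ≈-trans (++-cong (++-cong (⊗-identityˡ one) (⊗-identityˡ (neg P))) (⊗-identityʳ P)) (cancel-neg (evenPower (suc x))) ⟩
  one ∎k
  where
  D = eulerProduct x
  E = evenFactor x
  A = cappedPartitions (suc n) x
  G = cappedPartitions n (suc x)
  P = [ evenPower (suc x) ]
  -- multiplying by q^{2x+2} lifts precision 2n to 2n+2
  shift : 2 ℕ.* suc n ℕ.≤ 2 ℕ.* suc x ℕ.+ 2 ℕ.* n
  shift = subst (ℕ._≤ 2 ℕ.* suc x ℕ.+ 2 ℕ.* n) (sym (ℕP.*-suc 2 n))
            (ℕP.+-monoˡ-≤ (2 ℕ.* n) (subst (2 ℕ.≤_) (sym (ℕP.*-suc 2 x)) (ℕP.m≤m+n 2 (2 ℕ.* x))))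

-- When x+1 exceeds every admissible part only 1 - q^{2x+2} ≡ 1 is added.
euler-outside : ∀ n x → n ℕ.≤ x →
  eulerProduct x ⊗ cappedPartitions (suc n) x ≈[ 2 ℕ.* suc n ] one →
  eulerProduct (suc x) ⊗ cappedPartitions (suc n) (suc x) ≈[ 2 ℕ.* suc n ] one
euler-outside n x n≤x IH =
  (D ⊗ E) ⊗ cappedPartitions (suc n) (suc x)
    ≈⟨ ≈-trans (⊗-congʳ (D ⊗ E) (cappedPartitions-outside n x n≤x))
               (⊗-Solver.solve 3 (λ d e a → (d ⊕ e) ⊕ a ⊜ (d ⊕ a) ⊕ e) ≈-refl D E A) ⟩
  (D ⊗ A) ⊗ E
    ≈k⟨ ⊗-congˡk E IH ⟩
  one ⊗ E
    ≈⟨ ⊗-identityˡ E ⟩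
  E
    ≈k⟨ drop-high (term (+ 1) 0 (+ 0)) (term (ℤ.- (+ 1)) (2 ℕ.* x ℕ.+ 2) (+ 0)) high ⟩
  one ∎k
  where
  D = eulerProduct x
  E = evenFactor x
  A = cappedPartitions (suc n) x
  high : 2 ℕ.* suc n ℕ.≤ 2 ℕ.* x ℕ.+ 2
  high = subst (ℕ._≤ 2 ℕ.* x ℕ.+ 2) (trans (ℕP.+-comm (2 ℕ.* n) 2) (sym (ℕP.*-suc 2 n)))
           (ℕP.+-monoˡ-≤ 2 (ℕP.*-monoʳ-≤ 2 n≤x))

euler : ∀ n x → eulerProduct x ⊗ cappedPartitions n x ≈[ 2 ℕ.* n ] one
euler zero x = ≈k-intro λ j m ()
euler (suc n) zero = ≈⇒≈k (≈-trans (⊗-identityˡ _) (cappedPartitions-cap0 (suc n)))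
euler (suc n) (suc x) with x ℕ.<? n
... | yes x<n = euler-inside n x x<n (euler (suc n) x) (euler n (suc x))
... | no x≮n = euler-outside n x (ℕP.≮⇒≥ x≮n) (euler (suc n) x)

-- Every λ ⊂ δ_k has largest part ≤ k, so capping the parts at k+1 changes
-- nothing: G_{k+1} is the capped series G(k+1, k+1).
cap-vacuous : ∀ k lam → InsideStaircase (suc k) lam → weaklyDecreasing (suc k ∷ lam) ≡ weaklyDecreasing lam
cap-vacuous k [] inside = refl
cap-vacuous k (a ∷ rest) inside rewrite ≤ᵇ-yes {a} {suc k}
  (ℕP.≤-trans (ℕP.≤-pred (subst (_< suc k) (ℕP.+-identityʳ a) (inside 0 (s≤s z≤n)))) (ℕP.n≤1+n k)) = refl

partitionSeries≈capped : ∀ k → partitionSeries (suc k) ≈ cappedPartitions (suc k) (suc k)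
partitionSeries≈capped k = ≈-intro λ j m → begin
  ⟦ partitionSeries (suc k) ⟧ j m
    ≡⟨ trans (∑-map partitionTerm (filterᵇ weaklyDecreasing BL) _) (∑-filter weaklyDecreasing BL _) ⟩
  ∑ BL (λ lam → if weaklyDecreasing lam then contrib j m (partitionTerm lam) else + 0)
    ≡⟨ ∑-boundedLists-cong (suc k) (λ lam inside →
         cong (λ b → if b then contrib j m (partitionTerm lam) else + 0) (sym (cap-vacuous k lam inside))) ⟩
  ∑ BL (λ lam → if weaklyDecreasing (suc k ∷ lam) then contrib j m (partitionTerm lam) else + 0)
    ≡⟨ sym (trans (∑-map partitionTerm (filterᵇ (λ lam → weaklyDecreasing (suc k ∷ lam)) BL) _)
                  (∑-filter (λ lam → weaklyDecreasing (suc k ∷ lam)) BL _)) ⟩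
  ⟦ cappedPartitions (suc k) (suc k) ⟧ j m ∎
  where
  open ≡-Reasoning
  BL = boundedLists (bounds (suc k))

lhs≈prodUpTo : ∀ k → lhs (suc k) ≈[ suc k ] prodUpTo (suc k)
lhs≈prodUpTo k =
  lhs K
    ≈k⟨ lhs≈partition⊗arrows K ⟩
  partitionSeries K ⊗ emptyArrowSeries K
    ≈k⟨ ⊗-congʳk (partitionSeries K) (arrowSeries≈products K) ⟩
  partitionSeries K ⊗ (prodUpTo K ⊗ eulerProduct K)
    ≈⟨ ≈-trans (⊗-congˡ (prodUpTo K ⊗ eulerProduct K) (partitionSeries≈capped k))
         (⊗-Solver.solve 3 (λ g p d → g ⊕ (p ⊕ d) ⊜ p ⊕ (d ⊕ g)) ≈-refl (cappedPartitions K K) (prodUpTo K) (eulerProduct K)) ⟩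
  prodUpTo K ⊗ (eulerProduct K ⊗ cappedPartitions K K)
    ≈k⟨ ⊗-congʳk (prodUpTo K) (≈k-mono (ℕP.m≤m+n K (K ℕ.+ 0)) (euler K K)) ⟩
  prodUpTo K ⊗ one
    ≈⟨ ⊗-identityʳ (prodUpTo K) ⟩
  prodUpTo K ∎k
  where
  K = suc k

-- Step (4): the factor for i = n+1 is 1 modulo q^{2n+1}, so the finite
-- products stabilise.
factor≈one : ∀ n → factor n ≈[ 2 ℕ.* n ℕ.+ 1 ] one
factor≈one n =
  evenFactor n ⊗ (oddFactor⁺ n ⊗ oddFactor⁻ n)
    ≈k⟨ ⊗-congk (drop-high 1t (term (ℤ.- (+ 1)) (2 ℕ.* n ℕ.+ 2) (+ 0)) (ℕP.+-monoʳ-≤ (2 ℕ.* n) (s≤s z≤n)))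
          (⊗-congk (drop-high 1t (term (+ 1) (2 ℕ.* n ℕ.+ 1) (+ 1)) ℕP.≤-refl)
                   (drop-high 1t (term (+ 1) (2 ℕ.* n ℕ.+ 1) (ℤ.- (+ 1))) ℕP.≤-refl)) ⟩
  one ⊗ (one ⊗ one)
    ≈⟨ ≈-trans (⊗-identityˡ _) (⊗-identityˡ _) ⟩
  one ∎k
  where
  1t = term (+ 1) 0 (+ 0)

prodUpTo-stable : ∀ N d → prodUpTo (d ℕ.+ N) ≈[ N ] prodUpTo N
prodUpTo-stable N zero = ≈k-refl
prodUpTo-stable N (suc d) =
  prodUpTo (d ℕ.+ N) ⊗ factor (d ℕ.+ N)
    ≈k⟨ ⊗-congʳk (prodUpTo (d ℕ.+ N)) (≈k-mono N≤ (factor≈one (d ℕ.+ N))) ⟩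
  prodUpTo (d ℕ.+ N) ⊗ one
    ≈⟨ ⊗-identityʳ _ ⟩
  prodUpTo (d ℕ.+ N)
    ≈k⟨ prodUpTo-stable N d ⟩
  prodUpTo N ∎k
  where
  N≤ : N ℕ.≤ 2 ℕ.* (d ℕ.+ N) ℕ.+ 1
  N≤ = ℕP.≤-trans (ℕP.m≤n+m N d) (ℕP.≤-trans (ℕP.m≤m+n _ (d ℕ.+ N ℕ.+ 0)) (ℕP.m≤m+n _ 1))

prodUpTo-agree : ∀ {N M} → N ℕ.≤ M → prodUpTo M ≈[ N ] prodUpTo N
prodUpTo-agree {N} {M} N≤M =
  subst (λ M → prodUpTo M ≈[ N ] prodUpTo N) (ℕP.m∸n+n≡m N≤M) (prodUpTo-stable N (M ∸ N))

proposition5p3 : (k j : ℕ) (m : ℤ) → j < k → coeff j m (lhs k) ≡ rhsCoeff j m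
proposition5p3 zero j m ()
proposition5p3 (suc k) j m j<k = begin
  coeff j m (lhs (suc k))      ≡⟨ coeff≡⟦⟧ j m (lhs (suc k)) ⟩
  ⟦ lhs (suc k) ⟧ j m          ≡⟨ sameBelow (lhs≈prodUpTo k) j m j<k ⟩
  ⟦ prodUpTo (suc k) ⟧ j m     ≡⟨ sameBelow (prodUpTo-agree j<k) j m (ℕP.n<1+n j) ⟩
  ⟦ prodUpTo (suc j) ⟧ j m     ≡⟨ sym (coeff≡⟦⟧ j m (prodUpTo (suc j))) ⟩
  rhsCoeff j m                 ∎
  where open ≡-Reasoning
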